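{- Let $h$ and $k$ be integers with $4\le h\le k-1$. Let $A=\{a_0,a_1,\ldots,a_{k-1}\}$ be a set of $k$ nonnegative integers with $0=a_0<a_1<\cdots<a_{k-1}$. Let $A_h=\{a_0,a_1,\ldots,a_h\}$ and $A'=A\setminus\{a_0\}$. Suppose that $\left|h^{\wedge}_{\pm}A\right|=2hk-h(h+1)+1$ and that one of the following conditions holds: (a) $A$ is an arithmetic progression; (b) $A_h$ is an arithmetic progression; (c) $\left|h^{\wedge}_{\pm}A_h\right|\ge h(h+1)+1$ and $4\le h\le k-3$; (d) $h^{\wedge}_{\pm}A=h^{\wedge}(-A')\cup h^{\wedge}_{\pm}A_h\cup h^{\wedge}A'$ and $A'$ is an arithmetic progression; (e) $\left|h^{\wedge}_{\pm}A_h\right|\ge h(h+1)+1$ and $A'$ is an arithmetic progression. Then $A=a_1\ast[0,k-1]$.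
   Context: For a positive integer $h$ and a finite set of integers $A=\{a_1,\ldots,a_k\}$ (distinct elements), the restricted $h$-fold signed sumset is $h^{\wedge}_{\pm}A=\left\{\sum_{i=1}^k\lambda_i a_i:\lambda_i\in\{ -1,0,1\},\ \sum_{i=1}^k|\lambda_i|=h\right\}$, and the restricted $h$-fold sumset is $h^{\wedge}A=\left\{\sum_{i=1}^k\lambda_i a_i:\lambda_i\in\{0,1\},\ \sum_{i=1}^k\lambda_i=h\right\}$. For a set $S$ of integers, $-S=\{ -s:s\in S\}$ and $c\ast S=\{cs:s\in S\}$ for an integer $c$. For integers $a\le b$, $[a,b]=\{n\in\mathbb{Z}:a\le n\le b\}$. -}

module Defs where

open import Data.Nat using (ℕ; zero; suc)
open import Data.Integer using (ℤ; +_; _+_; _*_; -_; 0ℤ)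
open import Data.Integer.Properties using (_≟_)
open import Data.List using (List; []; _∷_; _++_; map; length; upTo; take; drop; deduplicate)
open import Data.List.Membership.DecPropositional _≟_ using (_∈_)
open import Data.Product using (∃; ∃-syntax; _×_)
open import Relation.Binary.PropositionalEquality using (_≡_)

-- A finite set of integers is represented by a list of its (distinct) elements.

-- signedSums h xs : all sums Σ λᵢ xᵢ with λᵢ ∈ {-1,0,1} and Σ |λᵢ| = h
-- (with repetitions); as a set this is h^∧_± xs.
signedSums : ℕ → List ℤ → List ℤ
signedSums zero    _        = 0ℤ ∷ []
signedSums (suc h) []       = []
signedSums (suc h) (x ∷ xs) =
  signedSums (suc h) xs ++ map (λ s → x + s) (signedSums h xs) ++ map (λ s → (- x) + s) (signedSums h xs)

restrictedSums : ℕ → List ℤ → List ℤ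
restrictedSums zero    _        = 0ℤ ∷ []
restrictedSums (suc h) []       = []
restrictedSums (suc h) (x ∷ xs) =
  restrictedSums (suc h) xs ++ map (λ s → x + s) (restrictedSums h xs)

card : List ℤ → ℕ
card xs = length (deduplicate _≟_ xs)

_^∧±_ : ℕ → List ℤ → List ℤ
h ^∧± xs = signedSums h xs

_^∧_ : ℕ → List ℤ → List ℤ
h ^∧ xs = restrictedSums h xs

neg : List ℤ → List ℤ
neg = map -_

elems : (ℕ → ℤ) → ℕ → List ℤ
elems a k = map a (upTo k)

IsAP : List ℤ → Set
IsAP xs = ∃[ c ] ∃[ d ] xs ≡ map (λ i → c + d * + i) (upTo (length xs))

_≐_ : List ℤ → List ℤ → Set
xs ≐ ys = ∀ z → (z ∈ xs → z ∈ ys) × (z ∈ ys → z ∈ xs)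

-- Adding a new largest element to a set of at least h+1 integers creates at least 2h new h-fold
-- signed sums: the h largest new sums and their negatives.  The first h+1 elements have at least
-- h(h+1)+1 signed sums (by hypothesis, or, when a 1, …, a h are in arithmetic progression, through
-- an explicit staircase of sums c m + d t), so |h^∧±A| ≥ h(h+1)+1 + 2h(k-h-1) = 2hk - h(h+1) + 1,
-- and equality makes the start and every step tight.  Two consecutive tight steps force the h+2
-- elements involved to be in arithmetic progression, hence A′ = c + d·[0, k-2] (for k = h+2 a direct
-- argument gives a (h+1) = (h+1) a 1); finally c ≠ d would give the staircase one sum too many, so
-- c = d and A = a 1 ∗ [0, k-1].
module Submission where

open import Data.Nat using (ℕ; suc; _≤_; _<_; _∸_)
open import Data.Nat as ℕ using ()
open import Data.Integer using (ℤ; +_; _*_)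
open import Data.Integer as ℤ using ()
open import Data.List using (take; drop; _++_)
open import Data.Product using (_×_; ∃-syntax)
open import Data.List.Membership.Propositional using (_∈_)
open import Data.Sum using (_⊎_)
open import Relation.Binary.PropositionalEquality using (_≡_)
open import Defs

open import Data.Nat using (zero; z≤n; s≤s)
import Data.Nat.Properties as NP
open import Data.Integer using (-_; 0ℤ; +[1+_])
import Data.Integer.Properties as ZP
open import Data.List using (List; []; _∷_; map; length; upTo; deduplicate; applyUpTo; applyDownFrom; [_])
import Data.List.Properties as LP
open import Data.List.Membership.Propositional using (_∉_)
open import Data.List.Membership.DecPropositional ZP._≟_ using (_∈?_)
import Data.List.Membership.Propositional.Properties as MP
open import Data.List.Relation.Unary.Any using (here; there; _─_)
open import Data.List.Relation.Unary.All as All using (All; _∷_)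
open import Function using (_∘′_)
open import Data.List.Relation.Unary.AllPairs using (_∷_)
open import Data.List.Relation.Unary.Unique.Propositional using (Unique)
import Data.List.Relation.Unary.Unique.Propositional.Properties as UniqueP
open import Data.List.Relation.Unary.Unique.DecPropositional.Properties ZP._≟_ using (deduplicate-!)
open import Data.List.Relation.Binary.Subset.Propositional using (_⊆_)
open import Data.Product using (_,_; proj₁; proj₂; Σ-syntax)
open import Data.Sum using (inj₁; inj₂)
open import Data.Empty using (⊥-elim)
open import Relation.Nullary using (¬_; Dec; yes; no)
open import Relation.Binary.PropositionalEquality using (module ≡-Reasoning; _≢_; refl; sym; trans; cong; cong₂; subst; subst₂)
open import Relation.Binary.Definitions using (tri<; tri≈; tri>)
open import Algebra.Properties.CommutativeSemigroup ZP.+-commutativeSemigroup using () renaming (x∙yz≈y∙xz to +-leftComm)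
open import Data.Integer.Tactic.RingSolver using (solve-∀)
open import Data.Nat.Tactic.RingSolver using () renaming (solve-∀ to ℕ-solve-∀)

module _ {A : Set} where

  ∈-─ : ∀ {x y : A} {xs} (x∈xs : x ∈ xs) → y ∈ xs → y ≢ x → y ∈ (xs ─ x∈xs)
  ∈-─ (here refl) (here refl) y≢x = ⊥-elim (y≢x refl)
  ∈-─ (here refl) (there y∈xs) _ = y∈xs
  ∈-─ (there _) (here y≡x) _ = here y≡x
  ∈-─ (there x∈xs) (there y∈xs) y≢x = there (∈-─ x∈xs y∈xs y≢x)

  Unique⊆⇒length≤ : ∀ {xs ys : List A} → Unique xs → xs ⊆ ys → length xs ≤ length ys
  Unique⊆⇒length≤ {[]} _ _ = z≤n
  Unique⊆⇒length≤ {x ∷ xs} {ys} (x∉xs ∷ xs!) xs⊆ys =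
    subst (suc (length xs) ≤_) (sym (LP.length-removeAt′ ys _))
      (s≤s (Unique⊆⇒length≤ xs! λ y∈xs → ∈-─ x∈ys (xs⊆ys (there y∈xs)) (distinct x∉xs y∈xs)))
    where
    x∈ys : x ∈ ys
    x∈ys = xs⊆ys (here refl)
    distinct : ∀ {y zs} → All (x ≢_) zs → y ∈ zs → y ≢ x
    distinct (x≢z ∷ _) (here refl) y≡x = x≢z (sym y≡x)
    distinct (_ ∷ ps) (there y∈zs) = distinct ps y∈zs

InjectiveBelow : ℕ → (ℕ → ℤ) → Set
InjectiveBelow N f = ∀ p q → p < q → q < N → f p ≢ f q

length+N≤card : ∀ {ys xs} N (f : ℕ → ℤ) → Unique ys → ys ⊆ xs → InjectiveBelow N f →
  (∀ p → p < N → f p ∈ xs) → (∀ p → p < N → f p ∉ ys) → length ys ℕ.+ N ≤ card xs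
length+N≤card {ys} {xs} N f ys! ys⊆xs f-inj f∈xs f∉ys =
  subst (_≤ card xs) length-new (Unique⊆⇒length≤ new! new⊆)
  where
  new : List ℤ
  new = applyDownFrom f N ++ ys
  length-new : length new ≡ length ys ℕ.+ N
  length-new = trans (LP.length-++ (applyDownFrom f N))
    (trans (cong (ℕ._+ length ys) (LP.length-applyDownFrom f N)) (NP.+-comm N (length ys)))
  new! : Unique new
  new! = UniqueP.++⁺ (UniqueP.applyDownFrom⁺₁ f N λ q<p p<N e → f-inj _ _ q<p p<N (sym e)) ys!
           λ (z∈f , z∈ys) → let (p , p<N , z≡fp) = MP.∈-applyDownFrom⁻ f z∈f in f∉ys p p<N (subst (_∈ ys) z≡fp z∈ys)
  new⊆ : new ⊆ deduplicate ZP._≟_ xs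
  new⊆ z∈new with MP.∈-++⁻ (applyDownFrom f N) z∈new
  ... | inj₁ z∈f = let (p , p<N , z≡fp) = MP.∈-applyDownFrom⁻ f z∈f in MP.∈-deduplicate⁺ ZP._≟_ (subst (_∈ xs) (sym z≡fp) (f∈xs p p<N))
  ... | inj₂ z∈ys = MP.∈-deduplicate⁺ ZP._≟_ (ys⊆xs z∈ys)

card-tight : ∀ {ys xs} N (f : ℕ → ℤ) → ys ⊆ xs → InjectiveBelow N f →
  (∀ p → p < N → f p ∈ xs) → (∀ p → p < N → f p ∉ ys) → card xs ≤ card ys ℕ.+ N →
  ∀ {z} → z ∈ xs → z ∈ ys ⊎ (Σ[ p ∈ ℕ ] p < N × z ≡ f p)
card-tight {ys} {xs} N f ys⊆xs f-inj f∈xs f∉ys tight {z} z∈xs with z ∈? ys | z ∈? applyUpTo f N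
... | yes z∈ys | _ = inj₁ z∈ys
... | no _ | yes z∈f = inj₂ (MP.∈-applyUpTo⁻ f z∈f)
... | no z∉ys | no z∉f = ⊥-elim (NP.<-irrefl refl (NP.<-≤-trans too-big tight))
  where
  zys! : Unique (z ∷ deduplicate ZP._≟_ ys)
  zys! = All.tabulate (λ w∈ z≡w → z∉ys (subst (_∈ ys) (sym z≡w) (MP.∈-deduplicate⁻ ZP._≟_ ys w∈)))
         ∷ deduplicate-! ys
  zys⊆xs : z ∷ deduplicate ZP._≟_ ys ⊆ xs
  zys⊆xs (here refl) = z∈xs
  zys⊆xs (there w∈) = ys⊆xs (MP.∈-deduplicate⁻ ZP._≟_ ys w∈)
  f∉zys : ∀ p → p < N → f p ∉ z ∷ deduplicate ZP._≟_ ys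
  f∉zys p p<N (here fp≡z) = z∉f (subst (_∈ applyUpTo f N) fp≡z (MP.∈-applyUpTo⁺ f p<N))
  f∉zys p p<N (there fp∈) = f∉ys p p<N (MP.∈-deduplicate⁻ ZP._≟_ ys fp∈)
  too-big : card ys ℕ.+ N < card xs
  too-big = length+N≤card N f zys! zys⊆xs f-inj f∈xs f∉zys

card-grows : ∀ {ys xs} N (f : ℕ → ℤ) → ys ⊆ xs → InjectiveBelow N f →
  (∀ p → p < N → f p ∈ xs) → (∀ p → p < N → f p ∉ ys) → card ys ℕ.+ N ≤ card xs
card-grows {ys} N f ys⊆xs f-inj f∈xs f∉ys =
  length+N≤card N f (deduplicate-! ys) (ys⊆xs ∘′ MP.∈-deduplicate⁻ ZP._≟_ ys) f-inj f∈xs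
    (λ p p<N fp∈ → f∉ys p p<N (MP.∈-deduplicate⁻ ZP._≟_ ys fp∈))

∈-signedSums-skip : ∀ h x xs {s} → s ∈ signedSums h xs → s ∈ signedSums h (x ∷ xs)
∈-signedSums-skip zero _ _ s∈ = s∈
∈-signedSums-skip (suc _) _ _ s∈ = MP.∈-++⁺ˡ s∈

module _ (h : ℕ) (x : ℤ) (xs : List ℤ) {s : ℤ} (s∈ : s ∈ signedSums h xs) where

  ∈-signedSums-add : x ℤ.+ s ∈ signedSums (suc h) (x ∷ xs)
  ∈-signedSums-add = MP.∈-++⁺ʳ (signedSums (suc h) xs) (MP.∈-++⁺ˡ (MP.∈-map⁺ (λ t → x ℤ.+ t) s∈))

  ∈-signedSums-sub : (- x) ℤ.+ s ∈ signedSums (suc h) (x ∷ xs)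
  ∈-signedSums-sub = MP.∈-++⁺ʳ (signedSums (suc h) xs)
    (MP.∈-++⁺ʳ (map (λ t → x ℤ.+ t) (signedSums h xs)) (MP.∈-map⁺ (λ t → (- x) ℤ.+ t) s∈))

∈-signedSums-∷⁻ : ∀ h x xs {z} → z ∈ signedSums (suc h) (x ∷ xs) →
  z ∈ signedSums (suc h) xs ⊎ (Σ[ t ∈ ℤ ] t ∈ signedSums h xs × (z ≡ x ℤ.+ t ⊎ z ≡ (- x) ℤ.+ t))
∈-signedSums-∷⁻ h x xs z∈ with MP.∈-++⁻ (signedSums (suc h) xs) z∈
... | inj₁ z∈skip = inj₁ z∈skip
... | inj₂ z∈± with MP.∈-++⁻ (map (λ t → x ℤ.+ t) (signedSums h xs)) z∈±
...   | inj₁ z∈add = let (t , t∈ , z≡) = MP.∈-map⁻ _ z∈add in inj₂ (t , t∈ , inj₁ z≡)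
...   | inj₂ z∈sub = let (t , t∈ , z≡) = MP.∈-map⁻ _ z∈sub in inj₂ (t , t∈ , inj₂ z≡)

neg-∈-signedSums : ∀ h xs {z} → z ∈ signedSums h xs → - z ∈ signedSums h xs
neg-∈-signedSums zero xs (here refl) = here refl
neg-∈-signedSums (suc h) (x ∷ xs) z∈ with ∈-signedSums-∷⁻ h x xs z∈
... | inj₁ z∈skip = ∈-signedSums-skip (suc h) x xs (neg-∈-signedSums (suc h) xs z∈skip)
... | inj₂ (t , t∈ , inj₁ refl) =
  subst (_∈ _) (sym (ZP.neg-distrib-+ x t)) (∈-signedSums-sub h x xs (neg-∈-signedSums h xs t∈))
... | inj₂ (t , t∈ , inj₂ refl) =
  subst (_∈ _) (sym (trans (ZP.neg-distrib-+ (- x) t) (cong (ℤ._+ - t) (ZP.neg-involutive x))))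
    (∈-signedSums-add h x xs (neg-∈-signedSums h xs t∈))

∈-signedSums-skipʳ : ∀ h xs y {s} → s ∈ signedSums h xs → s ∈ signedSums h (xs ++ [ y ])
∈-signedSums-skipʳ zero xs y s∈ = s∈
∈-signedSums-skipʳ (suc h) (x ∷ xs) y s∈ with ∈-signedSums-∷⁻ h x xs s∈
... | inj₁ s∈skip = ∈-signedSums-skip (suc h) x (xs ++ [ y ]) (∈-signedSums-skipʳ (suc h) xs y s∈skip)
... | inj₂ (t , t∈ , inj₁ refl) = ∈-signedSums-add h x (xs ++ [ y ]) (∈-signedSums-skipʳ h xs y t∈)
... | inj₂ (t , t∈ , inj₂ refl) = ∈-signedSums-sub h x (xs ++ [ y ]) (∈-signedSums-skipʳ h xs y t∈)

module _ (y : ℤ) where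

  ∈-signedSums-addʳ : ∀ h xs {s} → s ∈ signedSums h xs → y ℤ.+ s ∈ signedSums (suc h) (xs ++ [ y ])
  ∈-signedSums-addʳ zero [] (here refl) = ∈-signedSums-add 0 y [] (here refl)
  ∈-signedSums-addʳ zero (x ∷ xs) (here refl) = ∈-signedSums-skip 1 x (xs ++ [ y ]) (∈-signedSums-addʳ zero xs (here refl))
  ∈-signedSums-addʳ (suc h) (x ∷ xs) s∈ with ∈-signedSums-∷⁻ h x xs s∈
  ... | inj₁ s∈skip = ∈-signedSums-skip (suc (suc h)) x (xs ++ [ y ]) (∈-signedSums-addʳ (suc h) xs s∈skip)
  ... | inj₂ (t , t∈ , inj₁ refl) =
    subst (_∈ _) (+-leftComm x y t) (∈-signedSums-add (suc h) x (xs ++ [ y ]) (∈-signedSums-addʳ h xs t∈))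
  ... | inj₂ (t , t∈ , inj₂ refl) =
    subst (_∈ _) (+-leftComm (- x) y t) (∈-signedSums-sub (suc h) x (xs ++ [ y ]) (∈-signedSums-addʳ h xs t∈))

  ∈-signedSums-subʳ : ∀ h xs {s} → s ∈ signedSums h xs → (- y) ℤ.+ s ∈ signedSums (suc h) (xs ++ [ y ])
  ∈-signedSums-subʳ zero [] (here refl) = ∈-signedSums-sub 0 y [] (here refl)
  ∈-signedSums-subʳ zero (x ∷ xs) (here refl) = ∈-signedSums-skip 1 x (xs ++ [ y ]) (∈-signedSums-subʳ zero xs (here refl))
  ∈-signedSums-subʳ (suc h) (x ∷ xs) s∈ with ∈-signedSums-∷⁻ h x xs s∈
  ... | inj₁ s∈skip = ∈-signedSums-skip (suc (suc h)) x (xs ++ [ y ]) (∈-signedSums-subʳ (suc h) xs s∈skip)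
  ... | inj₂ (t , t∈ , inj₁ refl) =
    subst (_∈ _) (+-leftComm x (- y) t) (∈-signedSums-add (suc h) x (xs ++ [ y ]) (∈-signedSums-subʳ h xs t∈))
  ... | inj₂ (t , t∈ , inj₂ refl) =
    subst (_∈ _) (+-leftComm (- x) (- y) t) (∈-signedSums-sub (suc h) x (xs ++ [ y ]) (∈-signedSums-subʳ h xs t∈))

SplitAtLast : ℕ → List ℤ → ℤ → ℤ → Set
SplitAtLast h xs y z =
  z ∈ signedSums h xs ⊎
  (Σ[ h′ ∈ ℕ ] h ≡ suc h′ × (Σ[ s ∈ ℤ ] s ∈ signedSums h′ xs × (z ≡ y ℤ.+ s ⊎ z ≡ (- y) ℤ.+ s)))

∈-signedSums-∷ʳ⁻ : ∀ h xs y {z} → z ∈ signedSums h (xs ++ [ y ]) → SplitAtLast h xs y z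
∈-signedSums-∷ʳ⁻ zero xs y z∈ = inj₁ z∈
∈-signedSums-∷ʳ⁻ (suc h) [] y z∈ with ∈-signedSums-∷⁻ h y [] z∈
... | inj₂ (t , t∈ , z≡) = inj₂ (h , refl , t , t∈ , z≡)
∈-signedSums-∷ʳ⁻ (suc h) (x ∷ xs) y z∈ with ∈-signedSums-∷⁻ h x (xs ++ [ y ]) z∈
... | inj₁ z∈skip with ∈-signedSums-∷ʳ⁻ (suc h) xs y z∈skip
...   | inj₁ z∈xs = inj₁ (∈-signedSums-skip (suc h) x xs z∈xs)
...   | inj₂ (_ , refl , s , s∈ , z≡) = inj₂ (h , refl , s , ∈-signedSums-skip h x xs s∈ , z≡)
∈-signedSums-∷ʳ⁻ (suc h) (x ∷ xs) y z∈ | inj₂ (t , t∈ , z≡±x+t) with ∈-signedSums-∷ʳ⁻ h xs y t∈ | z≡±x+t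
... | inj₁ t∈xs | inj₁ refl = inj₁ (∈-signedSums-add h x xs t∈xs)
... | inj₁ t∈xs | inj₂ refl = inj₁ (∈-signedSums-sub h x xs t∈xs)
... | inj₂ (h′ , refl , s , s∈ , t≡±y+s) | _ = inj₂ (suc h′ , refl , reassociate z≡±x+t t≡±y+s)
  where
  reassociate : ∀ {z} → (z ≡ x ℤ.+ t ⊎ z ≡ (- x) ℤ.+ t) → (t ≡ y ℤ.+ s ⊎ t ≡ (- y) ℤ.+ s) →
    Σ[ w ∈ ℤ ] w ∈ signedSums (suc h′) (x ∷ xs) × (z ≡ y ℤ.+ w ⊎ z ≡ (- y) ℤ.+ w)
  reassociate (inj₁ refl) (inj₁ refl) = x ℤ.+ s , ∈-signedSums-add h′ x xs s∈ , inj₁ (+-leftComm x y s)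
  reassociate (inj₁ refl) (inj₂ refl) = x ℤ.+ s , ∈-signedSums-add h′ x xs s∈ , inj₂ (+-leftComm x (- y) s)
  reassociate (inj₂ refl) (inj₁ refl) = (- x) ℤ.+ s , ∈-signedSums-sub h′ x xs s∈ , inj₁ (+-leftComm (- x) y s)
  reassociate (inj₂ refl) (inj₂ refl) = (- x) ℤ.+ s , ∈-signedSums-sub h′ x xs s∈ , inj₂ (+-leftComm (- x) (- y) s)

data Sign : Set where
  minus none plus : Sign

⟦_⟧ : Sign → ℤ
⟦ minus ⟧ = - + 1
⟦ none ⟧ = 0ℤ
⟦ plus ⟧ = + 1

weight : Sign → ℕ
weight minus = 1
weight none = 0
weight plus = 1

setSign : (ℕ → Sign) → ℕ → Sign → ℕ → Sign
setSign e p s j with j ℕ.≟ p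
... | yes _ = s
... | no _ = e j

setSign-at : ∀ e p s → setSign e p s p ≡ s
setSign-at e p s with p ℕ.≟ p
... | yes _ = refl
... | no p≢p = ⊥-elim (p≢p refl)

setSign-other : ∀ e p s j → j ≢ p → setSign e p s j ≡ e j
setSign-other e p s j j≢p with j ℕ.≟ p
... | yes j≡p = ⊥-elim (j≢p j≡p)
... | no _ = refl

window : ℕ → ℕ → Sign
window lo j with lo ℕ.≤? j
... | yes _ = plus
... | no _ = none

window-in : ∀ lo j → lo ≤ j → window lo j ≡ plus
window-in lo j lo≤j with lo ℕ.≤? j
... | yes _ = refl
... | no lo≰j = ⊥-elim (lo≰j lo≤j)

window-out : ∀ lo j → j < lo → window lo j ≡ none
window-out lo j j<lo with lo ℕ.≤? j
... | yes lo≤j = ⊥-elim (NP.<-irrefl refl (NP.<-≤-trans j<lo lo≤j))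
... | no _ = refl

totalWeight : (ℕ → Sign) → ℕ → ℕ
totalWeight e zero = 0
totalWeight e (suc k) = weight (e k) ℕ.+ totalWeight e k

totalWeight-cong : ∀ e e′ k → (∀ j → j < k → e j ≡ e′ j) → totalWeight e k ≡ totalWeight e′ k
totalWeight-cong e e′ zero _ = refl
totalWeight-cong e e′ (suc k) e≗e′ =
  cong₂ (λ u s → weight s ℕ.+ u) (totalWeight-cong e e′ k (λ j j<k → e≗e′ j (NP.m<n⇒m<1+n j<k))) (e≗e′ k (NP.n<1+n k))

setSign-below : ∀ e p s → ∀ j → j < p → setSign e p s j ≡ e j
setSign-below e p s j j<p = setSign-other e p s j (λ j≡p → NP.<-irrefl j≡p j<p)

totalWeight-setSign : ∀ e p s k → p < k →
  totalWeight (setSign e p s) k ℕ.+ weight (e p) ≡ totalWeight e k ℕ.+ weight s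
totalWeight-setSign e p s (suc k) p<k with p ℕ.≟ k
... | yes refl =
  trans (cong₂ (λ u v → weight v ℕ.+ u ℕ.+ weight (e p)) (totalWeight-cong (setSign e p s) e p (setSign-below e p s)) (setSign-at e p s))
        (eq (weight s) (totalWeight e p) (weight (e p)))
  where
  eq : ∀ x y z → x ℕ.+ y ℕ.+ z ≡ z ℕ.+ y ℕ.+ x
  eq = ℕ-solve-∀
... | no p≢k =
  trans (cong (λ v → weight v ℕ.+ totalWeight (setSign e p s) k ℕ.+ weight (e p)) (setSign-other e p s k (λ k≡p → p≢k (sym k≡p))))
    (trans (NP.+-assoc (weight (e k)) _ _)
      (trans (cong (weight (e k) ℕ.+_) (totalWeight-setSign e p s k (NP.≤∧≢⇒< (NP.≤-pred p<k) p≢k)))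
             (sym (NP.+-assoc (weight (e k)) (totalWeight e k) (weight s)))))

totalWeight-window-below : ∀ lo k → k ≤ lo → totalWeight (window lo) k ≡ 0
totalWeight-window-below lo zero _ = refl
totalWeight-window-below lo (suc k) k<lo
  rewrite window-out lo k k<lo | totalWeight-window-below lo k (NP.≤-trans (NP.n≤1+n k) k<lo) = refl

totalWeight-window : ∀ lo n → totalWeight (window lo) (lo ℕ.+ n) ≡ n
totalWeight-window lo zero = totalWeight-window-below lo (lo ℕ.+ 0) (NP.≤-reflexive (NP.+-identityʳ lo))
totalWeight-window lo (suc n)
  rewrite NP.+-suc lo n | window-in lo (lo ℕ.+ n) (NP.m≤m+n lo n) | totalWeight-window lo n = refl

module Prefix (a : ℕ → ℤ) where

  S± : ℕ → ℕ → List ℤ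
  S± h k = signedSums h (elems a k)

  elems-suc : ∀ k → elems a (suc k) ≡ elems a k ++ [ a k ]
  elems-suc k = trans (cong (map a) (sym (LP.upTo-∷ʳ k))) (LP.map-++ a (upTo k) [ k ])

  S±-extend : ∀ h k {z} → z ∈ S± h k → z ∈ S± h (suc k)
  S±-extend h k z∈ = subst (λ l → _ ∈ signedSums h l) (sym (elems-suc k)) (∈-signedSums-skipʳ h (elems a k) (a k) z∈)

  S±-add : ∀ h k {z} → z ∈ S± h k → a k ℤ.+ z ∈ S± (suc h) (suc k)
  S±-add h k {z} z∈ = subst (λ l → a k ℤ.+ z ∈ signedSums (suc h) l) (sym (elems-suc k)) (∈-signedSums-addʳ (a k) h (elems a k) z∈)

  S±-sub : ∀ h k {z} → z ∈ S± h k → (- a k) ℤ.+ z ∈ S± (suc h) (suc k)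
  S±-sub h k {z} z∈ = subst (λ l → (- a k) ℤ.+ z ∈ signedSums (suc h) l) (sym (elems-suc k)) (∈-signedSums-subʳ (a k) h (elems a k) z∈)

  S±-suc⁻ : ∀ h k {z} → z ∈ S± h (suc k) → SplitAtLast h (elems a k) (a k) z
  S±-suc⁻ h k z∈ = ∈-signedSums-∷ʳ⁻ h (elems a k) (a k) (subst (λ l → _ ∈ signedSums h l) (elems-suc k) z∈)

  S±-neg : ∀ h k {z} → z ∈ S± h k → - z ∈ S± h k
  S±-neg h k = neg-∈-signedSums h (elems a k)

  combination : (ℕ → Sign) → ℕ → ℤ
  combination e zero = 0ℤ
  combination e (suc k) = combination e k ℤ.+ ⟦ e k ⟧ ℤ.* a k

  combination∈S± : ∀ e k → combination e k ∈ S± (totalWeight e k) k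
  combination∈S± e zero = here refl
  combination∈S± e (suc k) with e k
  ... | none = subst (_∈ S± (totalWeight e k) (suc k)) (eq (combination e k) (a k)) (S±-extend (totalWeight e k) k (combination∈S± e k))
    where
    eq : ∀ l x → l ≡ l ℤ.+ 0ℤ ℤ.* x
    eq = solve-∀
  ... | plus = subst (_∈ S± (suc (totalWeight e k)) (suc k)) (eq (combination e k) (a k)) (S±-add (totalWeight e k) k (combination∈S± e k))
    where
    eq : ∀ l x → x ℤ.+ l ≡ l ℤ.+ (+ 1) ℤ.* x
    eq = solve-∀
  ... | minus = subst (_∈ S± (suc (totalWeight e k)) (suc k)) (eq (combination e k) (a k)) (S±-sub (totalWeight e k) k (combination∈S± e k))
    where
    eq : ∀ l x → (- x) ℤ.+ l ≡ l ℤ.+ (- (+ 1)) ℤ.* x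
    eq = solve-∀

  combination-cong : ∀ e e′ k → (∀ j → j < k → e j ≡ e′ j) → combination e k ≡ combination e′ k
  combination-cong e e′ zero _ = refl
  combination-cong e e′ (suc k) e≗e′ =
    cong₂ (λ u s → u ℤ.+ ⟦ s ⟧ ℤ.* a k) (combination-cong e e′ k (λ j j<k → e≗e′ j (NP.m<n⇒m<1+n j<k))) (e≗e′ k (NP.n<1+n k))

  combination-setSign : ∀ e p s k → p < k →
    combination (setSign e p s) k ≡ combination e k ℤ.- ⟦ e p ⟧ ℤ.* a p ℤ.+ ⟦ s ⟧ ℤ.* a p
  combination-setSign e p s (suc k) p<k with p ℕ.≟ k
  ... | yes refl =
    trans (cong₂ (λ u v → u ℤ.+ ⟦ v ⟧ ℤ.* a p) (combination-cong (setSign e p s) e p (setSign-below e p s)) (setSign-at e p s))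
          (eq (combination e p) ⟦ e p ⟧ ⟦ s ⟧ (a p))
    where
    eq : ∀ l u v x → l ℤ.+ v ℤ.* x ≡ l ℤ.+ u ℤ.* x ℤ.- u ℤ.* x ℤ.+ v ℤ.* x
    eq = solve-∀
  ... | no p≢k =
    trans (cong₂ (λ u v → u ℤ.+ ⟦ v ⟧ ℤ.* a k) (combination-setSign e p s k (NP.≤∧≢⇒< (NP.≤-pred p<k) p≢k))
                                              (setSign-other e p s k (λ k≡p → p≢k (sym k≡p))))
          (eq (combination e k) ⟦ e p ⟧ ⟦ s ⟧ (a p) ⟦ e k ⟧ (a k))
    where
    eq : ∀ l u v x w y → l ℤ.- u ℤ.* x ℤ.+ v ℤ.* x ℤ.+ w ℤ.* y ≡ l ℤ.+ w ℤ.* y ℤ.- u ℤ.* x ℤ.+ v ℤ.* x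
    eq = solve-∀

  -- topSum h k = a (k-1) + ⋯ + a (k-h), the largest element of S± h k when a is increasing.
  topSum : ℕ → ℕ → ℤ
  topSum zero k = 0ℤ
  topSum (suc h) zero = 0ℤ
  topSum (suc h) (suc k) = a k ℤ.+ topSum h k

  topSum-suc : ∀ h k → suc h ≤ k → topSum (suc h) k ≡ topSum h k ℤ.+ a (k ∸ suc h)
  topSum-suc zero (suc k) _ = trans (ZP.+-identityʳ (a k)) (sym (ZP.+-identityˡ (a k)))
  topSum-suc (suc h) (suc k) (s≤s h<k) =
    trans (cong (λ t → a k ℤ.+ t) (topSum-suc h k h<k)) (sym (ZP.+-assoc (a k) (topSum h k) _))

  private
    combination-window-below : ∀ lo k → k ≤ lo → combination (window lo) k ≡ 0ℤ
    combination-window-below lo zero _ = refl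
    combination-window-below lo (suc k) k<lo
      rewrite window-out lo k k<lo | combination-window-below lo k (NP.≤-trans (NP.n≤1+n k) k<lo) = refl

  combination-window : ∀ lo n → combination (window lo) (lo ℕ.+ n) ≡ topSum n (lo ℕ.+ n)
  combination-window lo zero = combination-window-below lo (lo ℕ.+ 0) (NP.≤-reflexive (NP.+-identityʳ lo))
  combination-window lo (suc n)
    rewrite NP.+-suc lo n | window-in lo (lo ℕ.+ n) (NP.m≤m+n lo n) | combination-window lo n =
      eq (topSum n (lo ℕ.+ n)) (a (lo ℕ.+ n))
    where
    eq : ∀ m x → m ℤ.+ (+ 1) ℤ.* x ≡ x ℤ.+ m
    eq = solve-∀

  topSum∈S± : ∀ lo n → topSum n (lo ℕ.+ n) ∈ S± n (lo ℕ.+ n)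
  topSum∈S± lo n = subst₂ (λ u v → u ∈ S± v (lo ℕ.+ n)) (combination-window lo n) (totalWeight-window lo n)
    (combination∈S± (window lo) (lo ℕ.+ n))

  topSum-minus∈S± : ∀ lo g p → lo ≤ p → p < lo ℕ.+ suc g →
    topSum (suc g) (lo ℕ.+ suc g) ℤ.- a p ∈ S± g (lo ℕ.+ suc g)
  topSum-minus∈S± lo g p lo≤p p<k = subst₂ (λ u v → u ∈ S± v k) value size (combination∈S± e k)
    where
    k = lo ℕ.+ suc g
    e : ℕ → Sign
    e = setSign (window lo) p none
    value : combination e k ≡ topSum (suc g) k ℤ.- a p
    value rewrite combination-setSign (window lo) p none k p<k | window-in lo p lo≤p | combination-window lo (suc g) =
      eq (topSum (suc g) k) (a p)
      where
      eq : ∀ m x → m ℤ.- (+ 1) ℤ.* x ℤ.+ 0ℤ ℤ.* x ≡ m ℤ.- x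
      eq = solve-∀
    size : totalWeight e k ≡ g
    size = NP.+-cancelʳ-≡ 1 _ _ (trans
      (subst (λ s → totalWeight e k ℕ.+ weight s ≡ totalWeight (window lo) k ℕ.+ 0) (window-in lo p lo≤p)
        (totalWeight-setSign (window lo) p none k p<k))
      (trans (NP.+-identityʳ _) (trans (totalWeight-window lo (suc g)) (NP.+-comm 1 g))))

  topSum-minus₂∈S± : ∀ lo g p q → lo ≤ p → p < q → q < lo ℕ.+ suc (suc g) →
    topSum (suc (suc g)) (lo ℕ.+ suc (suc g)) ℤ.- a p ℤ.- a q ∈ S± g (lo ℕ.+ suc (suc g))
  topSum-minus₂∈S± lo g p q lo≤p p<q q<k = subst₂ (λ u v → u ∈ S± v k) value size (combination∈S± e k)
    where
    k = lo ℕ.+ suc (suc g)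
    p<k : p < k
    p<k = NP.<-trans p<q q<k
    e₁ : ℕ → Sign
    e₁ = setSign (window lo) p none
    e : ℕ → Sign
    e = setSign e₁ q none
    e₁q : e₁ q ≡ plus
    e₁q = trans (setSign-other (window lo) p none q (λ q≡p → NP.<-irrefl (sym q≡p) p<q))
                (window-in lo q (NP.≤-trans lo≤p (NP.<⇒≤ p<q)))
    value : combination e k ≡ topSum (suc (suc g)) k ℤ.- a p ℤ.- a q
    value rewrite combination-setSign e₁ q none k q<k | e₁q | combination-setSign (window lo) p none k p<k
                | window-in lo p lo≤p | combination-window lo (suc (suc g)) =
      eq (topSum (suc (suc g)) k) (a p) (a q)
      where
      eq : ∀ m x y → m ℤ.- (+ 1) ℤ.* x ℤ.+ 0ℤ ℤ.* x ℤ.- (+ 1) ℤ.* y ℤ.+ 0ℤ ℤ.* y ≡ m ℤ.- x ℤ.- y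
      eq = solve-∀
    w₁ : totalWeight e₁ k ℕ.+ 1 ≡ suc (suc g)
    w₁ = trans (subst (λ s → totalWeight e₁ k ℕ.+ weight s ≡ totalWeight (window lo) k ℕ.+ 0) (window-in lo p lo≤p)
                 (totalWeight-setSign (window lo) p none k p<k))
               (trans (NP.+-identityʳ _) (totalWeight-window lo (suc (suc g))))
    w₂ : totalWeight e k ℕ.+ 1 ≡ totalWeight e₁ k
    w₂ = trans (subst (λ s → totalWeight e k ℕ.+ weight s ≡ totalWeight e₁ k ℕ.+ 0) e₁q (totalWeight-setSign e₁ q none k q<k))
               (NP.+-identityʳ _)
    size : totalWeight e k ≡ g
    size = NP.+-cancelʳ-≡ 2 _ _ (trans (sym (NP.+-assoc (totalWeight e k) 1 1))
             (trans (cong (ℕ._+ 1) w₂) (trans w₁ (NP.+-comm 2 g))))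

≤-via-gap : ∀ x y d → y ≡ x ℤ.+ d → 0ℤ ℤ.≤ d → x ℤ.≤ y
≤-via-gap x y d refl 0≤d = subst (ℤ._≤ x ℤ.+ d) (ZP.+-identityʳ x) (ZP.+-monoʳ-≤ x 0≤d)

<-via-gap : ∀ x y d → y ≡ x ℤ.+ d → 0ℤ ℤ.< d → x ℤ.< y
<-via-gap x y d refl 0<d = subst (ℤ._< x ℤ.+ d) (ZP.+-identityʳ x) (ZP.+-monoʳ-< x 0<d)

i<j⇒0<j-i : ∀ {i j} → i ℤ.< j → 0ℤ ℤ.< j ℤ.- i
i<j⇒0<j-i {i} {j} i<j = subst (ℤ._< j ℤ.- i) (ZP.+-inverseʳ i) (ZP.+-monoˡ-< (- i) i<j)

+-cancelˡ-≡ : ∀ x {y z} → x ℤ.+ y ≡ x ℤ.+ z → y ≡ z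
+-cancelˡ-≡ x {y} {z} e = trans (eq x y) (trans (cong (λ t → (- x) ℤ.+ t) e) (sym (eq x z)))
  where
  eq : ∀ x y → y ≡ (- x) ℤ.+ (x ℤ.+ y)
  eq = solve-∀

i-j-k≡i-l-m⇒m≡j+k-l : ∀ i j k l m → i ℤ.- j ℤ.- k ≡ i ℤ.- l ℤ.- m → m ≡ j ℤ.+ k ℤ.- l
i-j-k≡i-l-m⇒m≡j+k-l i j k l m e = trans (eq₁ i l m) (trans (cong (λ t → i ℤ.- l ℤ.- t) (sym e)) (eq₂ i j k l))
  where
  eq₁ : ∀ i l m → m ≡ i ℤ.- l ℤ.- (i ℤ.- l ℤ.- m)
  eq₁ = solve-∀
  eq₂ : ∀ i j k l → i ℤ.- l ℤ.- (i ℤ.- j ℤ.- k) ≡ j ℤ.+ k ℤ.- l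
  eq₂ = solve-∀

i-j-k≡i-l⇒l≡j+k : ∀ i j k l → i ℤ.- j ℤ.- k ≡ i ℤ.- l → l ≡ j ℤ.+ k
i-j-k≡i-l⇒l≡j+k i j k l e = trans (eq₁ i l) (trans (cong (λ t → i ℤ.- t) (sym e)) (eq₂ i j k))
  where
  eq₁ : ∀ i l → l ≡ i ℤ.- (i ℤ.- l)
  eq₁ = solve-∀
  eq₂ : ∀ i j k → i ℤ.- (i ℤ.- j ℤ.- k) ≡ j ℤ.+ k
  eq₂ = solve-∀

i+j-k<i : ∀ i j k → j ℤ.< k → i ℤ.+ j ℤ.- k ℤ.< i
i+j-k<i i j k j<k = <-via-gap (i ℤ.+ j ℤ.- k) i (k ℤ.- j) (eq i j k) (i<j⇒0<j-i j<k)
  where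
  eq : ∀ i j k → i ≡ i ℤ.+ j ℤ.- k ℤ.+ (k ℤ.- j)
  eq = solve-∀

module Increasing (a : ℕ → ℤ) (K : ℕ) (a0 : a 0 ≡ 0ℤ) (a-step : ∀ i → suc i < K → a i ℤ.< a (suc i)) where
  open Prefix a public

  a-< : ∀ i j → i < j → j < K → a i ℤ.< a j
  a-< i (suc j) i<1+j 1+j<K with NP.m<1+n⇒m<n∨m≡n i<1+j
  ... | inj₁ i<j = ZP.<-trans (a-< i j i<j (NP.<-trans (NP.n<1+n j) 1+j<K)) (a-step j 1+j<K)
  ... | inj₂ refl = a-step i 1+j<K

  a-≤ : ∀ i j → i ≤ j → j < K → a i ℤ.≤ a j
  a-≤ i j i≤j j<K with NP.m≤n⇒m<n∨m≡n i≤j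
  ... | inj₁ i<j = ZP.<⇒≤ (a-< i j i<j j<K)
  ... | inj₂ refl = ZP.≤-refl

  a-<⁻ : ∀ i j → i < K → j < K → a i ℤ.< a j → i < j
  a-<⁻ i j i<K j<K ai<aj with NP.<-cmp i j
  ... | tri< i<j _ _ = i<j
  ... | tri≈ _ refl _ = ⊥-elim (ZP.<-irrefl refl ai<aj)
  ... | tri> _ _ j<i = ⊥-elim (ZP.<-asym ai<aj (a-< j i j<i i<K))

  a-injective : ∀ i j → i < K → j < K → a i ≡ a j → i ≡ j
  a-injective i j i<K j<K ai≡aj with NP.<-cmp i j
  ... | tri< i<j _ _ = ⊥-elim (ZP.<⇒≢ (a-< i j i<j j<K) ai≡aj)
  ... | tri≈ _ i≡j _ = i≡j
  ... | tri> _ _ j<i = ⊥-elim (ZP.<⇒≢ (a-< j i j<i i<K) (sym ai≡aj))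

  a-nonneg : ∀ j → j < K → 0ℤ ℤ.≤ a j
  a-nonneg j j<K = subst (ℤ._≤ a j) a0 (a-≤ 0 j z≤n j<K)

  a-pos : ∀ j → 0 < j → j < K → 0ℤ ℤ.< a j
  a-pos j 0<j j<K = subst (ℤ._< a j) a0 (a-< 0 j 0<j j<K)

  topSum-nonneg : ∀ h k → k ≤ K → 0ℤ ℤ.≤ topSum h k
  topSum-nonneg zero k _ = ZP.≤-refl
  topSum-nonneg (suc h) zero _ = ZP.≤-refl
  topSum-nonneg (suc h) (suc k) k<K = ZP.+-mono-≤ (a-nonneg k k<K) (topSum-nonneg h k (NP.≤-trans (NP.n≤1+n k) k<K))

  topSum-mono : ∀ h k → suc k ≤ K → topSum h k ℤ.≤ topSum h (suc k)
  topSum-mono zero k _ = ZP.≤-refl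
  topSum-mono (suc h) zero 0<K =
    subst (ℤ._≤ a 0 ℤ.+ topSum h 0) (ZP.+-identityʳ 0ℤ) (ZP.+-mono-≤ (a-nonneg 0 0<K) (topSum-nonneg h 0 z≤n))
  topSum-mono (suc h) (suc k) k<K =
    ZP.+-mono-≤ (ZP.<⇒≤ (a-step k k<K)) (topSum-mono h k (NP.≤-trans (NP.n≤1+n (suc k)) k<K))

  S±-bounded : ∀ h k {z} → k ≤ K → z ∈ S± h k → (- topSum h k) ℤ.≤ z × z ℤ.≤ topSum h k
  S±-bounded zero zero _ (here refl) = ZP.≤-refl , ZP.≤-refl
  S±-bounded h (suc k) {z} k<K z∈ with S±-suc⁻ h k z∈
  ... | inj₁ z∈old =
    let (lower , upper) = S±-bounded h k (NP.≤-trans (NP.n≤1+n k) k<K) z∈old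
    in ZP.≤-trans (ZP.neg-mono-≤ (topSum-mono h k k<K)) lower , ZP.≤-trans upper (topSum-mono h k k<K)
  ... | inj₂ (h′ , refl , s , s∈ , z≡) = with-last z≡ (S±-bounded h′ k (NP.≤-trans (NP.n≤1+n k) k<K) s∈)
    where
    -ak≤ak : (- a k) ℤ.≤ a k
    -ak≤ak = ZP.≤-trans (ZP.neg-mono-≤ (a-nonneg k k<K)) (a-nonneg k k<K)
    with-last : (z ≡ a k ℤ.+ s ⊎ z ≡ (- a k) ℤ.+ s) → (- topSum h′ k) ℤ.≤ s × s ℤ.≤ topSum h′ k →
      (- (a k ℤ.+ topSum h′ k)) ℤ.≤ z × z ℤ.≤ a k ℤ.+ topSum h′ k
    with-last (inj₁ refl) (lower , upper) =
      subst (ℤ._≤ a k ℤ.+ s) (sym (ZP.neg-distrib-+ (a k) (topSum h′ k))) (ZP.+-mono-≤ -ak≤ak lower) ,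
      ZP.+-monoʳ-≤ (a k) upper
    with-last (inj₂ refl) (lower , upper) =
      subst (ℤ._≤ (- a k) ℤ.+ s) (sym (ZP.neg-distrib-+ (a k) (topSum h′ k))) (ZP.+-monoʳ-≤ (- a k) lower) ,
      ZP.+-mono-≤ -ak≤ak upper

  -- Adding a (j+h) to {a 0, …, a (j+h-1)}: the h sums topSum (h+1) (j+h+1) - a (j+r), r < h,
  -- exceed every old h-fold signed sum, so they and their negatives are 2h new elements.
  module Growth (h : ℕ) where

    newSum : ℕ → ℕ → ℤ
    newSum j r = topSum (suc h) (suc (j ℕ.+ h)) ℤ.- a (j ℕ.+ r)

    newSum∈ : ∀ j r → r < suc h → newSum j r ∈ S± h (suc (j ℕ.+ h))
    newSum∈ j r r≤h = subst (λ m → newSum j r ∈ S± h m) (NP.+-suc j h)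
      (subst (λ m → topSum (suc h) m ℤ.- a (j ℕ.+ r) ∈ S± h (j ℕ.+ suc h)) (NP.+-suc j h)
        (topSum-minus∈S± j h (j ℕ.+ r) (NP.m≤m+n j r) (NP.+-monoʳ-< j r≤h)))

    newSum-above : ∀ j r → r < h → suc (j ℕ.+ h) ≤ K → topSum h (j ℕ.+ h) ℤ.< newSum j r
    newSum-above j r r<h j+h<K =
      <-via-gap _ _ (a (j ℕ.+ h) ℤ.- a (j ℕ.+ r)) (eq (a (j ℕ.+ h)) (topSum h (j ℕ.+ h)) (a (j ℕ.+ r)))
        (i<j⇒0<j-i (a-< (j ℕ.+ r) (j ℕ.+ h) (NP.+-monoʳ-< j r<h) j+h<K))
      where
      eq : ∀ x m y → x ℤ.+ m ℤ.- y ≡ m ℤ.+ (x ℤ.- y)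
      eq = solve-∀

    newSum-pos : ∀ j r → r < h → suc (j ℕ.+ h) ≤ K → 0ℤ ℤ.< newSum j r
    newSum-pos j r r<h j+h<K =
      ZP.≤-<-trans (topSum-nonneg h (j ℕ.+ h) (NP.≤-trans (NP.n≤1+n _) j+h<K)) (newSum-above j r r<h j+h<K)

    newSum-injective : ∀ j r r′ → r < r′ → j ℕ.+ r′ < K → newSum j r ≢ newSum j r′
    newSum-injective j r r′ r<r′ j+r′<K e = NP.<-irrefl
      (NP.+-cancelˡ-≡ j _ _ (a-injective (j ℕ.+ r) (j ℕ.+ r′) (NP.<-trans (NP.+-monoʳ-< j r<r′) j+r′<K) j+r′<K
        (ZP.neg-injective (+-cancelˡ-≡ (topSum (suc h) (suc (j ℕ.+ h))) e))))
      r<r′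

    private
      ∸h<h : ∀ p → ¬ (p < h) → p < h ℕ.+ h → p ∸ h < h
      ∸h<h p p≮h p<2h = NP.+-cancelˡ-< h _ _ (subst (_< h ℕ.+ h) (sym (NP.m+[n∸m]≡n (NP.≮⇒≥ p≮h))) p<2h)

    newSums : ℕ → ℕ → ℤ
    newSums j p with p ℕ.<? h
    ... | yes _ = - newSum j p
    ... | no _ = newSum j (p ∸ h)

    newSums∈ : ∀ j p → p < h ℕ.+ h → newSums j p ∈ S± h (suc (j ℕ.+ h))
    newSums∈ j p p<2h with p ℕ.<? h
    ... | yes p<h = S±-neg h _ (newSum∈ j p (NP.m<n⇒m<1+n p<h))
    ... | no p≮h = newSum∈ j (p ∸ h) (NP.m<n⇒m<1+n (∸h<h p p≮h p<2h))

    newSums∉ : ∀ j p → p < h ℕ.+ h → suc (j ℕ.+ h) ≤ K → newSums j p ∉ S± h (j ℕ.+ h)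
    newSums∉ j p p<2h j+h<K old with p ℕ.<? h | S±-bounded h (j ℕ.+ h) (NP.≤-trans (NP.n≤1+n _) j+h<K) old
    ... | yes p<h | lower , _ = ZP.<-irrefl refl (ZP.≤-<-trans lower (ZP.neg-mono-< (newSum-above j p p<h j+h<K)))
    ... | no p≮h | _ , upper = ZP.<-irrefl refl (ZP.<-≤-trans (newSum-above j (p ∸ h) (∸h<h p p≮h p<2h) j+h<K) upper)

    newSums-injective : ∀ j → suc (j ℕ.+ h) ≤ K → InjectiveBelow (h ℕ.+ h) (newSums j)
    newSums-injective j j+h<K p q p<q q<2h e with p ℕ.<? h | q ℕ.<? h
    ... | yes p<h | yes q<h = newSum-injective j p q p<q (NP.<-trans (NP.+-monoʳ-< j q<h) j+h<K) (ZP.neg-injective e)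
    ... | yes p<h | no q≮h = ZP.<-asym (ZP.neg-mono-< (newSum-pos j p p<h j+h<K))
                               (subst (0ℤ ℤ.<_) (sym e) (newSum-pos j (q ∸ h) (∸h<h q q≮h q<2h) j+h<K))
    ... | no p≮h | yes q<h = p≮h (NP.<-trans p<q q<h)
    ... | no p≮h | no q≮h = newSum-injective j (p ∸ h) (q ∸ h) (NP.∸-monoˡ-< p<q (NP.≮⇒≥ p≮h))
                              (NP.<-trans (NP.+-monoʳ-< j (∸h<h q q≮h q<2h)) j+h<K) e

    S±-card-step : ∀ j → suc (j ℕ.+ h) ≤ K → card (S± h (j ℕ.+ h)) ℕ.+ (h ℕ.+ h) ≤ card (S± h (suc (j ℕ.+ h)))
    S±-card-step j j+h<K = card-grows (h ℕ.+ h) (newSums j) (S±-extend h (j ℕ.+ h)) (newSums-injective j j+h<K)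
      (newSums∈ j) (λ p p<2h → newSums∉ j p p<2h j+h<K)

    TightStep : ℕ → Set
    TightStep j = card (S± h (suc (j ℕ.+ h))) ≤ card (S± h (j ℕ.+ h)) ℕ.+ (h ℕ.+ h)

    S±-tight-step : ∀ j → suc (j ℕ.+ h) ≤ K → TightStep j → ∀ {z} → z ∈ S± h (suc (j ℕ.+ h)) →
      z ∈ S± h (j ℕ.+ h) ⊎ (Σ[ r ∈ ℕ ] r < h × (z ≡ newSum j r ⊎ z ≡ - newSum j r))
    S±-tight-step j j+h<K tight z∈
      with card-tight (h ℕ.+ h) (newSums j) (S±-extend h (j ℕ.+ h)) (newSums-injective j j+h<K) (newSums∈ j)
             (λ p p<2h → newSums∉ j p p<2h j+h<K) tight z∈
    ... | inj₁ z∈old = inj₁ z∈old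
    ... | inj₂ (p , p<2h , z≡) with p ℕ.<? h
    ...   | yes p<h = inj₂ (p , p<h , inj₂ z≡)
    ...   | no p≮h = inj₂ (p ∸ h , ∸h<h p p≮h p<2h , inj₁ z≡)

    S±-tight-step-above : ∀ j → suc (j ℕ.+ h) ≤ K → TightStep j → ∀ {z} → z ∈ S± h (suc (j ℕ.+ h)) →
      topSum h (j ℕ.+ h) ℤ.< z → Σ[ r ∈ ℕ ] r < h × z ≡ newSum j r
    S±-tight-step-above j j+h<K tight z∈ z> with S±-tight-step j j+h<K tight z∈
    ... | inj₁ z∈old = ⊥-elim (ZP.<-irrefl refl (ZP.<-≤-trans z> (proj₂ (S±-bounded h (j ℕ.+ h) (NP.≤-trans (NP.n≤1+n _) j+h<K) z∈old))))
    ... | inj₂ (r , r<h , inj₁ z≡) = r , r<h , z≡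
    ... | inj₂ (r , r<h , inj₂ refl) = ⊥-elim (ZP.<-asym (ZP.neg-mono-< (newSum-pos j r r<h j+h<K))
                                         (ZP.≤-<-trans (topSum-nonneg h (j ℕ.+ h) (NP.≤-trans (NP.n≤1+n _) j+h<K)) z>))

    S±-tight-step-within : ∀ j → suc (j ℕ.+ h) ≤ K → TightStep j → ∀ {z} → z ∈ S± h (suc (j ℕ.+ h)) →
      z ℤ.≤ topSum h (j ℕ.+ h) → (- topSum h (j ℕ.+ h)) ℤ.≤ z → z ∈ S± h (j ℕ.+ h)
    S±-tight-step-within j j+h<K tight z∈ upper lower with S±-tight-step j j+h<K tight z∈
    ... | inj₁ z∈old = z∈old
    ... | inj₂ (r , r<h , inj₁ refl) = ⊥-elim (ZP.<-irrefl refl (ZP.<-≤-trans (newSum-above j r r<h j+h<K) upper))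
    ... | inj₂ (r , r<h , inj₂ refl) = ⊥-elim (ZP.<-irrefl refl (ZP.≤-<-trans lower (ZP.neg-mono-< (newSum-above j r r<h j+h<K))))

module LinearGrowth (D : ℕ → ℕ) (n g : ℕ) (step : ∀ t → suc t ≤ n → D t ℕ.+ g ≤ D (suc t)) where

  grows : ∀ s t → s ℕ.+ t ≤ n → D s ℕ.+ t ℕ.* g ≤ D (s ℕ.+ t)
  grows s zero _ = NP.≤-reflexive (trans (NP.+-identityʳ (D s)) (cong D (sym (NP.+-identityʳ s))))
  grows s (suc t) s+t<n = begin
    D s ℕ.+ suc t ℕ.* g      ≡⟨ eq (D s) t g ⟩
    D s ℕ.+ t ℕ.* g ℕ.+ g    ≤⟨ NP.+-monoˡ-≤ g (grows s t (NP.<⇒≤ s+t<n′)) ⟩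
    D (s ℕ.+ t) ℕ.+ g        ≤⟨ step (s ℕ.+ t) s+t<n′ ⟩
    D (suc (s ℕ.+ t))        ≡⟨ cong D (sym (NP.+-suc s t)) ⟩
    D (s ℕ.+ suc t)          ∎
    where
    open NP.≤-Reasoning
    s+t<n′ : suc (s ℕ.+ t) ≤ n
    s+t<n′ = subst (_≤ n) (NP.+-suc s t) s+t<n
    eq : ∀ x t g → x ℕ.+ suc t ℕ.* g ≡ x ℕ.+ t ℕ.* g ℕ.+ g
    eq = ℕ-solve-∀

  module _ (B : ℕ) (B≤D₀ : B ≤ D 0) (Dₙ≤ : D n ≤ B ℕ.+ n ℕ.* g) where

    start-exact : D 0 ≤ B
    start-exact = NP.+-cancelʳ-≤ (n ℕ.* g) (D 0) B (NP.≤-trans (grows 0 n NP.≤-refl) Dₙ≤)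

    step-exact : ∀ t → suc t ≤ n → D (suc t) ≤ D t ℕ.+ g
    step-exact t t<n with NP.m≤n⇒∃[o]m+o≡n t<n
    ... | m , refl = NP.+-cancelʳ-≤ (m ℕ.* g) (D (suc t)) (D t ℕ.+ g) (begin
      D (suc t) ℕ.+ m ℕ.* g            ≤⟨ grows (suc t) m NP.≤-refl ⟩
      D (suc t ℕ.+ m)                  ≤⟨ Dₙ≤ ⟩
      B ℕ.+ (suc t ℕ.+ m) ℕ.* g        ≡⟨ eq B t m g ⟩
      B ℕ.+ t ℕ.* g ℕ.+ g ℕ.+ m ℕ.* g  ≤⟨ NP.+-monoˡ-≤ (m ℕ.* g) (NP.+-monoˡ-≤ g D-lower) ⟩
      D t ℕ.+ g ℕ.+ m ℕ.* g            ∎)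
      where
      open NP.≤-Reasoning
      eq : ∀ B t m g → B ℕ.+ (suc t ℕ.+ m) ℕ.* g ≡ B ℕ.+ t ℕ.* g ℕ.+ g ℕ.+ m ℕ.* g
      eq = ℕ-solve-∀
      D-lower : B ℕ.+ t ℕ.* g ≤ D t
      D-lower = NP.≤-trans (NP.+-monoˡ-≤ (t ℕ.* g) B≤D₀) (grows 0 t (NP.≤-trans (NP.n≤1+n t) (NP.m≤m+n (suc t) m)))

-- Points (m , t) of the staircase stand for c m + d t, which is the signed sum Σ λⱼ a (j+1) when
-- a (j+1) = c + d j, with m = Σ λⱼ and t = Σ j λⱼ.  For h = 4 + n we list h(h+1)+1 points realized by
-- h-fold signed sums of {0, a 1, …, a h}, consecutive ones differing by (1 , 0) or (0 , 1), so that
-- for c, d > 0 their values strictly increase.  The list for h + 1 consists of the first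
-- stairSplit n points for h with a (h+1) subtracted, followed by the points from index 5 on with
-- a (h+1) added; for h = 4 it is realized by the sign patterns baseSigns.
pattern stairHeight n = suc (suc (suc (suc n)))

stairHeightℤ : ℕ → ℤ
stairHeightℤ n = + stairHeight n

stairSplit : ℕ → ℕ
stairSplit n = 2 ℕ.* stairHeight n ℕ.+ 7

stairShift : ℕ → ℕ
stairShift n = 2 ℕ.* stairHeight n ℕ.+ 2

stairLength : ℕ → ℕ
stairLength zero = 21
stairLength (suc n) = stairLength n ℕ.+ stairShift n

FiveSigns : Set
FiveSigns = Sign × Sign × Sign × Sign × Sign

signVector : FiveSigns → ℕ → Sign
signVector (s₀ , _) 0 = s₀
signVector (_ , s₁ , _) 1 = s₁
signVector (_ , _ , s₂ , _) 2 = s₂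
signVector (_ , _ , _ , s₃ , _) 3 = s₃
signVector (_ , _ , _ , _ , s₄) 4 = s₄
signVector _ _ = none

signsM signsT : FiveSigns → ℤ
signsM (_ , s₁ , s₂ , s₃ , s₄) = ⟦ s₁ ⟧ ℤ.+ ⟦ s₂ ⟧ ℤ.+ ⟦ s₃ ⟧ ℤ.+ ⟦ s₄ ⟧
signsT (_ , _ , s₂ , s₃ , s₄) = ⟦ s₂ ⟧ ℤ.+ ⟦ s₃ ⟧ ℤ.* + 2 ℤ.+ ⟦ s₄ ⟧ ℤ.* + 3

baseSigns : ℕ → FiveSigns
baseSigns 0 = none , minus , minus , minus , minus
baseSigns 1 = plus , none , minus , minus , minus
baseSigns 2 = plus , minus , none , minus , minus
baseSigns 3 = plus , minus , minus , none , minus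
baseSigns 4 = none , minus , plus , minus , minus
baseSigns 5 = plus , none , plus , minus , minus
baseSigns 6 = plus , plus , minus , minus , none
baseSigns 7 = plus , minus , plus , none , minus
baseSigns 8 = none , plus , minus , plus , minus
baseSigns 9 = plus , plus , plus , none , minus
baseSigns 10 = plus , plus , none , plus , minus
baseSigns 11 = plus , none , plus , plus , minus
baseSigns 12 = plus , plus , minus , plus , none
baseSigns 13 = plus , none , plus , minus , plus
baseSigns 14 = plus , minus , plus , plus , none
baseSigns 15 = plus , minus , plus , none , plus
baseSigns 16 = none , plus , minus , plus , plus
baseSigns 17 = plus , plus , plus , none , plus
baseSigns 18 = plus , plus , none , plus , plus
baseSigns 19 = plus , none , plus , plus , plus
baseSigns _ = none , plus , plus , plus , plus

baseSigns-weight : ∀ p → totalWeight (signVector (baseSigns p)) 5 ≡ 4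
baseSigns-weight 0 = refl
baseSigns-weight 1 = refl
baseSigns-weight 2 = refl
baseSigns-weight 3 = refl
baseSigns-weight 4 = refl
baseSigns-weight 5 = refl
baseSigns-weight 6 = refl
baseSigns-weight 7 = refl
baseSigns-weight 8 = refl
baseSigns-weight 9 = refl
baseSigns-weight 10 = refl
baseSigns-weight 11 = refl
baseSigns-weight 12 = refl
baseSigns-weight 13 = refl
baseSigns-weight 14 = refl
baseSigns-weight 15 = refl
baseSigns-weight 16 = refl
baseSigns-weight 17 = refl
baseSigns-weight 18 = refl
baseSigns-weight 19 = refl
baseSigns-weight (suc (suc (suc (suc (suc (suc (suc (suc (suc (suc (suc (suc (suc (suc (suc (suc (suc (suc (suc (suc _)))))))))))))))))))) = refl

stairM stairT : ℕ → ℕ → ℤ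
stairM zero p = signsM (baseSigns p)
stairM (suc n) p with p ℕ.<? stairSplit n
... | yes _ = stairM n p ℤ.- + 1
... | no _ = stairM n (p ∸ stairShift n) ℤ.+ + 1
stairT zero p = signsT (baseSigns p)
stairT (suc n) p with p ℕ.<? stairSplit n
... | yes _ = stairT n p ℤ.- stairHeightℤ n
... | no _ = stairT n (p ∸ stairShift n) ℤ.+ stairHeightℤ n

module _ (n p : ℕ) where

  stairM-low : p < stairSplit n → stairM (suc n) p ≡ stairM n p ℤ.- + 1
  stairM-low p<s with p ℕ.<? stairSplit n
  ... | yes _ = refl
  ... | no p≮s = ⊥-elim (p≮s p<s)

  stairT-low : p < stairSplit n → stairT (suc n) p ≡ stairT n p ℤ.- stairHeightℤ n
  stairT-low p<s with p ℕ.<? stairSplit n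
  ... | yes _ = refl
  ... | no p≮s = ⊥-elim (p≮s p<s)

  stairM-high : ¬ (p < stairSplit n) → stairM (suc n) p ≡ stairM n (p ∸ stairShift n) ℤ.+ + 1
  stairM-high p≮s with p ℕ.<? stairSplit n
  ... | yes p<s = ⊥-elim (p≮s p<s)
  ... | no _ = refl

  stairT-high : ¬ (p < stairSplit n) → stairT (suc n) p ≡ stairT n (p ∸ stairShift n) ℤ.+ stairHeightℤ n
  stairT-high p≮s with p ℕ.<? stairSplit n
  ... | yes p<s = ⊥-elim (p≮s p<s)
  ... | no _ = refl

stairLength≡ : ∀ n → stairLength n ≡ stairHeight n ℕ.* suc (stairHeight n) ℕ.+ 1
stairLength≡ zero = refl
stairLength≡ (suc n) = trans (cong (ℕ._+ stairShift n) (stairLength≡ n)) (eq n)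
  where
  eq : ∀ n → stairHeight n ℕ.* suc (stairHeight n) ℕ.+ 1 ℕ.+ (2 ℕ.* stairHeight n ℕ.+ 2) ≡ stairHeight (suc n) ℕ.* suc (stairHeight (suc n)) ℕ.+ 1
  eq = ℕ-solve-∀

stairSplit<stairLength : ∀ n → stairSplit n < stairLength n
stairSplit<stairLength n =
  subst (stairSplit n <_) (sym (trans (stairLength≡ n) (eq n))) (NP.m<m+n (stairSplit n) {6 ℕ.+ (n ℕ.* n ℕ.+ 7 ℕ.* n)} (s≤s z≤n))
  where
  eq : ∀ n → stairHeight n ℕ.* suc (stairHeight n) ℕ.+ 1 ≡ (2 ℕ.* stairHeight n ℕ.+ 7) ℕ.+ (6 ℕ.+ (n ℕ.* n ℕ.+ 7 ℕ.* n))
  eq = ℕ-solve-∀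

stairShift≤ : ∀ n p → ¬ (p < stairSplit n) → stairShift n ≤ p
stairShift≤ n p p≮s = NP.≤-trans (NP.+-monoʳ-≤ (2 ℕ.* stairHeight n) (NP.m≤m+n 2 5)) (NP.≮⇒≥ p≮s)

stairSplit∸stairShift : ∀ n → stairSplit n ∸ stairShift n ≡ 5
stairSplit∸stairShift n = trans (cong (_∸ stairShift n) (sym (NP.+-assoc (2 ℕ.* stairHeight n) 2 5))) (NP.m+n∸m≡n (stairShift n) 5)

stairSplit-suc∸stairShift : ∀ n → stairSplit (suc n) ∸ stairShift n ≡ 7
stairSplit-suc∸stairShift n = trans (cong (_∸ stairShift n) (eq n)) (NP.m+n∸m≡n (stairShift n) 7)
  where
  eq : ∀ n → 2 ℕ.* stairHeight (suc n) ℕ.+ 7 ≡ (2 ℕ.* stairHeight n ℕ.+ 2) ℕ.+ 7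
  eq = ℕ-solve-∀

stairHeightℤ-suc : ∀ n → stairHeightℤ (suc n) ≡ stairHeightℤ n ℤ.+ + 1
stairHeightℤ-suc n = trans (cong +_ (NP.+-comm 1 (stairHeight n))) (ZP.pos-+ (stairHeight n) 1)

11<stairSplit : ∀ n → 11 < stairSplit n
11<stairSplit n = NP.+-monoˡ-< 7 (NP.<-≤-trans (s≤s (s≤s (s≤s (s≤s (s≤s z≤n))))) (NP.*-monoʳ-≤ 2 (NP.m≤m+n 4 n)))

stairSplit-suc≮ : ∀ n → ¬ (stairSplit (suc n) < stairSplit n)
stairSplit-suc≮ n q = NP.<-asym q (NP.+-monoˡ-< 7 (NP.*-monoʳ-< 2 (NP.n<1+n (stairHeight n))))

≤11⇒<stairSplit : ∀ {i} n → i ≤ 11 → i < stairSplit n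
≤11⇒<stairSplit n i≤11 = NP.≤-<-trans i≤11 (11<stairSplit n)

5<stairSplit : ∀ n → 5 < stairSplit n
5<stairSplit n = ≤11⇒<stairSplit n (NP.m≤m+n 5 6)

7<stairSplit : ∀ n → 7 < stairSplit n
7<stairSplit n = ≤11⇒<stairSplit n (NP.m≤m+n 7 4)

stair-5-7 : ∀ n → stairM n 7 ≡ stairM n 5 × stairT n 7 ≡ stairT n 5 ℤ.+ + 2
stair-5-7 zero = refl , refl
stair-5-7 (suc n)
  rewrite stairM-low n 7 (7<stairSplit n) | stairT-low n 7 (7<stairSplit n) | stairM-low n 5 (5<stairSplit n) | stairT-low n 5 (5<stairSplit n)
  with stair-5-7 n
... | e₁ , e₂ = cong (ℤ._- + 1) e₁ , trans (cong (ℤ._- stairHeightℤ n) e₂) (eq (stairT n 5) (stairHeightℤ n))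
  where
  eq : ∀ x y → x ℤ.+ + 2 ℤ.- y ≡ x ℤ.- y ℤ.+ + 2
  eq = solve-∀

stair-5-split : ∀ n → stairM n (stairSplit n) ≡ stairM n 5 ℤ.+ + 2
                    × stairT n (stairSplit n) ≡ stairT n 5 ℤ.+ stairHeightℤ n ℤ.+ stairHeightℤ n
stair-5-split zero = refl , refl
stair-5-split (suc n)
  rewrite stairM-high n (stairSplit (suc n)) (stairSplit-suc≮ n) | stairT-high n (stairSplit (suc n)) (stairSplit-suc≮ n)
        | stairSplit-suc∸stairShift n | stairM-low n 5 (5<stairSplit n) | stairT-low n 5 (5<stairSplit n) | stairHeightℤ-suc n
  with stair-5-7 n
... | e₁ , e₂ rewrite e₁ | e₂ = eq₁ (stairM n 5) , eq₂ (stairT n 5) (stairHeightℤ n)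
  where
  eq₁ : ∀ x → x ℤ.+ + 1 ≡ x ℤ.- + 1 ℤ.+ + 2
  eq₁ = solve-∀
  eq₂ : ∀ x y → x ℤ.+ + 2 ℤ.+ y ≡ x ℤ.- y ℤ.+ (y ℤ.+ + 1) ℤ.+ (y ℤ.+ + 1)
  eq₂ = solve-∀

stair-4-5 : ∀ n → stairM n 5 ≡ stairM n 4 ℤ.+ + 1 × stairT n 5 ≡ stairT n 4
stair-4-5 zero = refl , refl
stair-4-5 (suc n)
  rewrite stairM-low n 5 (5<stairSplit n) | stairT-low n 5 (5<stairSplit n)
        | stairM-low n 4 (≤11⇒<stairSplit n (NP.m≤m+n 4 7)) | stairT-low n 4 (≤11⇒<stairSplit n (NP.m≤m+n 4 7))
  with stair-4-5 n
... | e₁ , e₂ rewrite e₁ | e₂ = eq (stairM n 4) , refl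
  where
  eq : ∀ x → x ℤ.+ + 1 ℤ.- + 1 ≡ x ℤ.- + 1 ℤ.+ + 1
  eq = solve-∀

stair-10-11 : ∀ n → stairM n 11 ≡ stairM n 10 × stairT n 11 ≡ stairT n 10 ℤ.+ + 1
stair-10-11 zero = refl , refl
stair-10-11 (suc n)
  rewrite stairM-low n 11 (11<stairSplit n) | stairT-low n 11 (11<stairSplit n)
        | stairM-low n 10 (≤11⇒<stairSplit n (NP.n≤1+n 10)) | stairT-low n 10 (≤11⇒<stairSplit n (NP.n≤1+n 10))
  with stair-10-11 n
... | e₁ , e₂ rewrite e₁ | e₂ = refl , eq (stairT n 10) (stairHeightℤ n)
  where
  eq : ∀ x y → x ℤ.+ + 1 ℤ.- y ≡ x ℤ.- y ℤ.+ + 1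
  eq = solve-∀

StairStep : ℕ → ℕ → Set
StairStep n p = (stairM n (suc p) ≡ stairM n p ℤ.+ + 1 × stairT n (suc p) ≡ stairT n p)
              ⊎ (stairM n (suc p) ≡ stairM n p × stairT n (suc p) ≡ stairT n p ℤ.+ + 1)

base-step : ∀ p → suc p < 21 → StairStep 0 p
base-step 0 _ = inj₁ (refl , refl)
base-step 1 _ = inj₂ (refl , refl)
base-step 2 _ = inj₂ (refl , refl)
base-step 3 _ = inj₁ (refl , refl)
base-step 4 _ = inj₁ (refl , refl)
base-step 5 _ = inj₂ (refl , refl)
base-step 6 _ = inj₂ (refl , refl)
base-step 7 _ = inj₁ (refl , refl)
base-step 8 _ = inj₁ (refl , refl)
base-step 9 _ = inj₂ (refl , refl)
base-step 10 _ = inj₂ (refl , refl)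
base-step 11 _ = inj₂ (refl , refl)
base-step 12 _ = inj₂ (refl , refl)
base-step 13 _ = inj₂ (refl , refl)
base-step 14 _ = inj₂ (refl , refl)
base-step 15 _ = inj₁ (refl , refl)
base-step 16 _ = inj₁ (refl , refl)
base-step 17 _ = inj₂ (refl , refl)
base-step 18 _ = inj₂ (refl , refl)
base-step 19 _ = inj₁ (refl , refl)
base-step (suc (suc (suc (suc (suc (suc (suc (suc (suc (suc (suc (suc (suc (suc (suc (suc (suc (suc (suc (suc p)))))))))))))))))))) 21<21+p =
  ⊥-elim (NP.<-irrefl refl (NP.≤-<-trans (NP.m≤m+n 21 p) 21<21+p))

StairStep-shift : ∀ n q n′ p x y → StairStep n q →
  stairM n′ (suc p) ≡ stairM n (suc q) ℤ.+ x → stairM n′ p ≡ stairM n q ℤ.+ x →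
  stairT n′ (suc p) ≡ stairT n (suc q) ℤ.+ y → stairT n′ p ≡ stairT n q ℤ.+ y → StairStep n′ p
StairStep-shift n q n′ p x y (inj₁ (e₁ , e₂)) f₁ f₂ g₁ g₂ rewrite f₁ | f₂ | g₁ | g₂ | e₁ | e₂ =
  inj₁ (eq (stairM n q) x , refl)
  where
  eq : ∀ u x → u ℤ.+ + 1 ℤ.+ x ≡ u ℤ.+ x ℤ.+ + 1
  eq = solve-∀
StairStep-shift n q n′ p x y (inj₂ (e₁ , e₂)) f₁ f₂ g₁ g₂ rewrite f₁ | f₂ | g₁ | g₂ | e₁ | e₂ =
  inj₂ (refl , eq (stairT n q) y)
  where
  eq : ∀ u x → u ℤ.+ + 1 ℤ.+ x ≡ u ℤ.+ x ℤ.+ + 1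
  eq = solve-∀

stair-step : ∀ n p → suc p < stairLength n → StairStep n p
stair-step zero p p<l = base-step p p<l
stair-step (suc n) p p<l with NP.<-cmp (suc p) (stairSplit n)
... | tri< p<s _ _ =
  StairStep-shift n p (suc n) p (- + 1) (- stairHeightℤ n) (stair-step n p (NP.<-trans p<s (stairSplit<stairLength n)))
    (stairM-low n (suc p) p<s) (stairM-low n p (NP.<-trans (NP.n<1+n p) p<s))
    (stairT-low n (suc p) p<s) (stairT-low n p (NP.<-trans (NP.n<1+n p) p<s))
... | tri≈ _ p≡s _ =
  StairStep-shift n p (suc n) p (- + 1) (- stairHeightℤ n) (stair-step n p (subst (_< stairLength n) (sym p≡s) (stairSplit<stairLength n)))
    M-across (stairM-low n p p<s) T-across (stairT-low n p p<s)
  where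
  -- at the join the new point p + 1 is old point 5 shifted up; stair-5-split turns the step into an old one
  p<s : p < stairSplit n
  p<s = subst (p <_) p≡s (NP.n<1+n p)
  p≮s : ¬ (suc p < stairSplit n)
  p≮s = NP.<-irrefl p≡s
  back-to-5 : suc p ∸ stairShift n ≡ 5
  back-to-5 = trans (cong (_∸ stairShift n) p≡s) (stairSplit∸stairShift n)
  M-across : stairM (suc n) (suc p) ≡ stairM n (suc p) ℤ.+ (- + 1)
  M-across = trans (stairM-high n (suc p) p≮s) (trans (cong (λ w → stairM n w ℤ.+ + 1) back-to-5)
    (trans (eq (stairM n 5)) (cong (ℤ._+ (- + 1)) (sym (trans (cong (stairM n) p≡s) (proj₁ (stair-5-split n)))))))
    where
    eq : ∀ u → u ℤ.+ + 1 ≡ u ℤ.+ + 2 ℤ.+ (- + 1)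
    eq = solve-∀
  T-across : stairT (suc n) (suc p) ≡ stairT n (suc p) ℤ.+ (- stairHeightℤ n)
  T-across = trans (stairT-high n (suc p) p≮s) (trans (cong (λ w → stairT n w ℤ.+ stairHeightℤ n) back-to-5)
    (trans (eq (stairT n 5) (stairHeightℤ n)) (cong (ℤ._+ (- stairHeightℤ n)) (sym (trans (cong (stairT n) p≡s) (proj₂ (stair-5-split n)))))))
    where
    eq : ∀ u y → u ℤ.+ y ≡ u ℤ.+ y ℤ.+ y ℤ.+ (- y)
    eq = solve-∀
... | tri> _ _ s<p =
  StairStep-shift n (p ∸ stairShift n) (suc n) p (+ 1) (stairHeightℤ n) (stair-step n (p ∸ stairShift n) q<l)
    (trans (stairM-high n (suc p) 1+p≮s) (cong (λ w → stairM n w ℤ.+ + 1) suc-∸)) (stairM-high n p p≮s)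
    (trans (stairT-high n (suc p) 1+p≮s) (cong (λ w → stairT n w ℤ.+ stairHeightℤ n) suc-∸)) (stairT-high n p p≮s)
  where
  1+p≮s : ¬ (suc p < stairSplit n)
  1+p≮s q = NP.<-asym q s<p
  p≮s : ¬ (p < stairSplit n)
  p≮s q = NP.<-irrefl refl (NP.<-≤-trans q (NP.≤-pred s<p))
  suc-∸ : suc p ∸ stairShift n ≡ suc (p ∸ stairShift n)
  suc-∸ = NP.+-∸-assoc 1 (stairShift≤ n p p≮s)
  q<l : suc (p ∸ stairShift n) < stairLength n
  q<l = subst (_< stairLength n) suc-∸
    (subst (suc p ∸ stairShift n <_) (NP.m+n∸n≡m (stairLength n) (stairShift n))
      (NP.∸-monoˡ-< p<l (NP.≤-trans (stairShift≤ n p p≮s) (NP.n≤1+n p))))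

module APStaircase (a : ℕ → ℤ) (a0 : a 0 ≡ 0ℤ) (c d : ℤ) (H : ℕ)
                   (a-AP : ∀ j → j < H → a (suc j) ≡ c ℤ.+ d ℤ.* + j) where
  open Prefix a

  Realizable : ℕ → ℤ → ℤ → Set
  Realizable h m t = c ℤ.* m ℤ.+ d ℤ.* t ∈ S± h (suc h)

  realizable-add : ∀ h m t → h < H → Realizable h m t → Realizable (suc h) (m ℤ.+ + 1) (t ℤ.+ + h)
  realizable-add h m t h<H r = subst (_∈ S± (suc h) (suc (suc h)))
    (trans (cong (ℤ._+ (c ℤ.* m ℤ.+ d ℤ.* t)) (a-AP h h<H)) (eq c d m t (+ h))) (S±-add h (suc h) r)
    where
    eq : ∀ c d m t x → c ℤ.+ d ℤ.* x ℤ.+ (c ℤ.* m ℤ.+ d ℤ.* t) ≡ c ℤ.* (m ℤ.+ + 1) ℤ.+ d ℤ.* (t ℤ.+ x)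
    eq = solve-∀

  realizable-sub : ∀ h m t → h < H → Realizable h m t → Realizable (suc h) (m ℤ.- + 1) (t ℤ.- + h)
  realizable-sub h m t h<H r = subst (_∈ S± (suc h) (suc (suc h)))
    (trans (cong (λ w → (- w) ℤ.+ (c ℤ.* m ℤ.+ d ℤ.* t)) (a-AP h h<H)) (eq c d m t (+ h))) (S±-sub h (suc h) r)
    where
    eq : ∀ c d m t x → (- (c ℤ.+ d ℤ.* x)) ℤ.+ (c ℤ.* m ℤ.+ d ℤ.* t) ≡ c ℤ.* (m ℤ.- + 1) ℤ.+ d ℤ.* (t ℤ.- x)
    eq = solve-∀

  realizable-signVector : ∀ σ → 4 ≤ H → totalWeight (signVector σ) 5 ≡ 4 → Realizable 4 (signsM σ) (signsT σ)
  realizable-signVector σ@(s₀ , s₁ , s₂ , s₃ , s₄) 4≤H weight≡4 =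
    subst₂ (λ u v → u ∈ S± v 5) value weight≡4 (combination∈S± (signVector σ) 5)
    where
    value : combination (signVector σ) 5 ≡ c ℤ.* signsM σ ℤ.+ d ℤ.* signsT σ
    value rewrite a0 | a-AP 0 (NP.<-≤-trans (s≤s z≤n) 4≤H) | a-AP 1 (NP.<-≤-trans (s≤s (s≤s z≤n)) 4≤H)
                | a-AP 2 (NP.<-≤-trans (s≤s (s≤s (s≤s z≤n))) 4≤H) | a-AP 3 4≤H = eq c d ⟦ s₀ ⟧ ⟦ s₁ ⟧ ⟦ s₂ ⟧ ⟦ s₃ ⟧ ⟦ s₄ ⟧
      where
      eq : ∀ c d x₀ x₁ x₂ x₃ x₄ →
        0ℤ ℤ.+ x₀ ℤ.* 0ℤ ℤ.+ x₁ ℤ.* (c ℤ.+ d ℤ.* + 0) ℤ.+ x₂ ℤ.* (c ℤ.+ d ℤ.* + 1) ℤ.+ x₃ ℤ.* (c ℤ.+ d ℤ.* + 2)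
          ℤ.+ x₄ ℤ.* (c ℤ.+ d ℤ.* + 3)
        ≡ c ℤ.* (x₁ ℤ.+ x₂ ℤ.+ x₃ ℤ.+ x₄) ℤ.+ d ℤ.* (x₂ ℤ.+ x₃ ℤ.* + 2 ℤ.+ x₄ ℤ.* + 3)
      eq = solve-∀

  stair-realizable : ∀ n → stairHeight n ≤ H → ∀ p → p < stairLength n →
    Realizable (stairHeight n) (stairM n p) (stairT n p)
  stair-realizable zero 4≤H p _ = realizable-signVector (baseSigns p) 4≤H (baseSigns-weight p)
  stair-realizable (suc n) h<H p p<l = by-cases (p ℕ.<? stairSplit n)
    where
    by-cases : Dec (p < stairSplit n) → Realizable (suc (stairHeight n)) (stairM (suc n) p) (stairT (suc n) p)
    by-cases (yes p<s) = subst₂ (Realizable (suc (stairHeight n))) (sym (stairM-low n p p<s)) (sym (stairT-low n p p<s))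
      (realizable-sub (stairHeight n) _ _ h<H (stair-realizable n (NP.<⇒≤ h<H) p (NP.<-trans p<s (stairSplit<stairLength n))))
    by-cases (no p≮s) = subst₂ (Realizable (suc (stairHeight n))) (sym (stairM-high n p p≮s)) (sym (stairT-high n p p≮s))
      (realizable-add (stairHeight n) _ _ h<H (stair-realizable n (NP.<⇒≤ h<H) (p ∸ stairShift n) q<l))
      where
      q<l : p ∸ stairShift n < stairLength n
      q<l = subst (p ∸ stairShift n <_) (NP.m+n∸n≡m (stairLength n) (stairShift n)) (NP.∸-monoˡ-< p<l (stairShift≤ n p p≮s))

  -- Two points off the staircase, next to points 4 and 10.
  detourA-realizable : ∀ n → stairHeight n ≤ H → Realizable (stairHeight n) (stairM n 4 ℤ.+ + 1) (stairT n 4 ℤ.- + 1)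
  detourA-realizable zero 4≤H = realizable-signVector (plus , plus , none , minus , minus) 4≤H refl
  detourA-realizable (suc n) h<H = subst₂ (Realizable (suc (stairHeight n)))
    (trans (eq₁ (stairM n 4)) (cong (ℤ._+ + 1) (sym (stairM-low n 4 (≤11⇒<stairSplit n (NP.m≤m+n 4 7))))))
    (trans (eq₂ (stairT n 4) (stairHeightℤ n)) (cong (ℤ._- + 1) (sym (stairT-low n 4 (≤11⇒<stairSplit n (NP.m≤m+n 4 7))))))
    (realizable-sub (stairHeight n) _ _ h<H (detourA-realizable n (NP.<⇒≤ h<H)))
    where
    eq₁ : ∀ u → u ℤ.+ + 1 ℤ.- + 1 ≡ u ℤ.- + 1 ℤ.+ + 1
    eq₁ = solve-∀
    eq₂ : ∀ u y → u ℤ.- + 1 ℤ.- y ≡ u ℤ.- y ℤ.- + 1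
    eq₂ = solve-∀

  detourB-realizable : ∀ n → stairHeight n ≤ H → Realizable (stairHeight n) (stairM n 10 ℤ.- + 1) (stairT n 10 ℤ.+ + 1)
  detourB-realizable zero 4≤H = realizable-signVector (none , minus , plus , plus , minus) 4≤H refl
  detourB-realizable (suc n) h<H = subst₂ (Realizable (suc (stairHeight n)))
    (cong (ℤ._- + 1) (sym (stairM-low n 10 (≤11⇒<stairSplit n (NP.n≤1+n 10)))))
    (trans (eq (stairT n 10) (stairHeightℤ n)) (cong (ℤ._+ + 1) (sym (stairT-low n 10 (≤11⇒<stairSplit n (NP.n≤1+n 10))))))
    (realizable-sub (stairHeight n) _ _ h<H (detourB-realizable n (NP.<⇒≤ h<H)))
    where
    eq : ∀ u y → u ℤ.+ + 1 ℤ.- y ≡ u ℤ.- y ℤ.+ + 1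
    eq = solve-∀

  module Values (n : ℕ) (h≤H : stairHeight n ≤ H) (c>0 : 0ℤ ℤ.< c) (d>0 : 0ℤ ℤ.< d) where

    stairValue : ℕ → ℤ
    stairValue p = c ℤ.* stairM n p ℤ.+ d ℤ.* stairT n p

    stairValue-step : ∀ p → suc p < stairLength n → stairValue p ℤ.< stairValue (suc p)
    stairValue-step p p<N with stair-step n p p<N
    ... | inj₁ (e₁ , e₂) = <-via-gap _ _ c (trans (cong₂ (λ u w → c ℤ.* u ℤ.+ d ℤ.* w) e₁ e₂) (eq c d (stairM n p) (stairT n p))) c>0
      where
      eq : ∀ c d u w → c ℤ.* (u ℤ.+ + 1) ℤ.+ d ℤ.* w ≡ c ℤ.* u ℤ.+ d ℤ.* w ℤ.+ c
      eq = solve-∀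
    ... | inj₂ (e₁ , e₂) = <-via-gap _ _ d (trans (cong₂ (λ u w → c ℤ.* u ℤ.+ d ℤ.* w) e₁ e₂) (eq c d (stairM n p) (stairT n p))) d>0
      where
      eq : ∀ c d u w → c ℤ.* u ℤ.+ d ℤ.* (w ℤ.+ + 1) ≡ c ℤ.* u ℤ.+ d ℤ.* w ℤ.+ d
      eq = solve-∀

    stairValue-< : ∀ p q → p < q → q < stairLength n → stairValue p ℤ.< stairValue q
    stairValue-< p (suc q) p<1+q 1+q<N with NP.m<1+n⇒m<n∨m≡n p<1+q
    ... | inj₁ p<q = ZP.<-trans (stairValue-< p q p<q (NP.<-trans (NP.n<1+n q) 1+q<N)) (stairValue-step q 1+q<N)
    ... | inj₂ refl = stairValue-step p 1+q<N

    stairValue-injective : InjectiveBelow (stairLength n) stairValue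
    stairValue-injective p q p<q q<N = ZP.<⇒≢ (stairValue-< p q p<q q<N)

    stairValue-<⁻ : ∀ p q → p < stairLength n → q < stairLength n → stairValue p ℤ.< stairValue q → p < q
    stairValue-<⁻ p q p<N q<N vp<vq with NP.<-cmp p q
    ... | tri< p<q _ _ = p<q
    ... | tri≈ _ refl _ = ⊥-elim (ZP.<-irrefl refl vp<vq)
    ... | tri> _ _ q<p = ⊥-elim (ZP.<-asym vp<vq (stairValue-< q p q<p p<N))

    stairValue-gap : ∀ w p → suc p < stairLength n → stairValue p ℤ.< w → w ℤ.< stairValue (suc p) →
      ∀ q → q < stairLength n → w ≢ stairValue q
    stairValue-gap w p 1+p<N vp<w w<v1+p q q<N refl =
      NP.<-irrefl refl (NP.<-≤-trans (stairValue-<⁻ q (suc p) q<N 1+p<N w<v1+p) (stairValue-<⁻ p q (NP.<-trans (NP.n<1+n p) 1+p<N) q<N vp<w))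

    stairValue∈ : ∀ p → p < stairLength n → stairValue p ∈ S± (stairHeight n) (suc (stairHeight n))
    stairValue∈ = stair-realizable n h≤H

    stair-card-≥ : (stairLength n) ≤ card (S± (stairHeight n) (suc (stairHeight n)))
    stair-card-≥ = card-grows {[]} (stairLength n) stairValue (λ ()) stairValue-injective stairValue∈ (λ _ _ ())

    stair-card-tight : card (S± (stairHeight n) (suc (stairHeight n))) ≤ stairLength n →
      ∀ {z} → z ∈ S± (stairHeight n) (suc (stairHeight n)) → Σ[ p ∈ ℕ ] p < stairLength n × z ≡ stairValue p
    stair-card-tight tight z∈ with card-tight {[]} (stairLength n) stairValue (λ ()) stairValue-injective stairValue∈ (λ _ _ ()) tight z∈
    ... | inj₂ z-on-stair = z-on-stair

    private
      extra-point : ∀ w → w ∈ S± (stairHeight n) (suc (stairHeight n)) → (∀ q → q < stairLength n → w ≢ stairValue q) →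
        suc (stairLength n) ≤ card (S± (stairHeight n) (suc (stairHeight n)))
      extra-point w w∈ w-off = card-grows {[ w ]} (stairLength n) stairValue (λ { (here refl) → w∈ }) stairValue-injective stairValue∈
        (λ { p p<N (here vp≡w) → w-off p p<N (sym vp≡w) })

    -- If c ≠ d, one of the two detour points lies strictly between two consecutive stair values.
    stair-card-> : c ≢ d → suc (stairLength n) ≤ card (S± (stairHeight n) (suc (stairHeight n)))
    stair-card-> c≢d with ZP.<-cmp c d
    ... | tri≈ _ c≡d _ = ⊥-elim (c≢d c≡d)
    ... | tri> _ _ d<c = extra-point w (detourA-realizable n h≤H) (stairValue-gap w 4 5<N above below)
      where
      5<N : 5 < stairLength n
      5<N = NP.<-trans (5<stairSplit n) (stairSplit<stairLength n)
      w : ℤ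
      w = c ℤ.* (stairM n 4 ℤ.+ + 1) ℤ.+ d ℤ.* (stairT n 4 ℤ.- + 1)
      above : stairValue 4 ℤ.< w
      above = <-via-gap _ w (c ℤ.- d) (eq c d (stairM n 4) (stairT n 4)) (i<j⇒0<j-i d<c)
        where
        eq : ∀ c d u v → c ℤ.* (u ℤ.+ + 1) ℤ.+ d ℤ.* (v ℤ.- + 1) ≡ c ℤ.* u ℤ.+ d ℤ.* v ℤ.+ (c ℤ.- d)
        eq = solve-∀
      below : w ℤ.< stairValue 5
      below = <-via-gap w _ d
        (trans (cong₂ (λ x y → c ℤ.* x ℤ.+ d ℤ.* y) (proj₁ (stair-4-5 n)) (proj₂ (stair-4-5 n))) (eq c d (stairM n 4) (stairT n 4))) d>0
        where
        eq : ∀ c d u v → c ℤ.* (u ℤ.+ + 1) ℤ.+ d ℤ.* v ≡ c ℤ.* (u ℤ.+ + 1) ℤ.+ d ℤ.* (v ℤ.- + 1) ℤ.+ d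
        eq = solve-∀
    ... | tri< c<d _ _ = extra-point w (detourB-realizable n h≤H) (stairValue-gap w 10 11<N above below)
      where
      11<N : 11 < stairLength n
      11<N = NP.<-trans (11<stairSplit n) (stairSplit<stairLength n)
      w : ℤ
      w = c ℤ.* (stairM n 10 ℤ.- + 1) ℤ.+ d ℤ.* (stairT n 10 ℤ.+ + 1)
      above : stairValue 10 ℤ.< w
      above = <-via-gap _ w (d ℤ.- c) (eq c d (stairM n 10) (stairT n 10)) (i<j⇒0<j-i c<d)
        where
        eq : ∀ c d u v → c ℤ.* (u ℤ.- + 1) ℤ.+ d ℤ.* (v ℤ.+ + 1) ≡ c ℤ.* u ℤ.+ d ℤ.* v ℤ.+ (d ℤ.- c)
        eq = solve-∀
      below : w ℤ.< stairValue 11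
      below = <-via-gap w _ c
        (trans (cong₂ (λ x y → c ℤ.* x ℤ.+ d ℤ.* y) (proj₁ (stair-10-11 n)) (proj₂ (stair-10-11 n))) (eq c d (stairM n 10) (stairT n 10))) c>0
        where
        eq : ∀ c d u v → c ℤ.* u ℤ.+ d ℤ.* (v ℤ.+ + 1) ≡ c ℤ.* (u ℤ.- + 1) ℤ.+ d ℤ.* (v ℤ.+ + 1) ℤ.+ c
        eq = solve-∀

squeeze : ∀ m j → m < j → j < suc (suc m) → j ≡ suc m
squeeze m j m<j j<2+m = NP.≤-antisym (NP.≤-pred j<2+m) m<j

-- Two consecutive tight steps, adding a (i+h) and then a (i+h+1), force a (i), …, a (i+h+1) to be an
-- arithmetic progression.  Everything is read off the h-fold sums top - a p - a q, i ≤ p < q ≤ i+h+1,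
-- of the window sum top = a i + ⋯ + a (i+h+1): those above topSum h (i+h) must be new sums of one
-- of the two steps.
module Rigidity (a : ℕ → ℤ) (K : ℕ) (a0 : a 0 ≡ 0ℤ) (a-step : ∀ i → suc i < K → a i ℤ.< a (suc i))
                (h : ℕ) (3≤h : 3 ≤ h) where
  open Increasing a K a0 a-step
  open Growth h

  gap : ℕ → ℤ
  gap j = a (suc j) ℤ.- a j

  module Window (i : ℕ) (k<K : suc (suc (i ℕ.+ h)) ≤ K) (tight₀ : TightStep i) (tight₁ : TightStep (suc i)) where

    k : ℕ
    k = suc (i ℕ.+ h)

    top : ℤ
    top = topSum (suc (suc h)) (suc k)

    top-k top-i : ℕ → ℤ
    top-k m = top ℤ.- a k ℤ.- a m
    top-i m = top ℤ.- a i ℤ.- a m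

    top-i≡ : topSum (suc h) (suc k) ≡ top ℤ.- a i
    top-i≡ = trans (eq (topSum (suc h) (suc k)) (a i)) (cong (ℤ._- a i) (sym (trans (topSum-suc (suc h) (suc k) (s≤s (s≤s (NP.m≤n+m h i))))
      (cong (λ w → topSum (suc h) (suc k) ℤ.+ a w) (NP.m+n∸n≡m i h)))))
      where
      eq : ∀ x y → x ≡ x ℤ.+ y ℤ.- y
      eq = solve-∀

    newSum≡top-k : ∀ r → newSum i r ≡ top-k (i ℕ.+ r)
    newSum≡top-k r = cong (ℤ._- a (i ℕ.+ r)) (eq (a k) (topSum (suc h) k))
      where
      eq : ∀ x y → y ≡ x ℤ.+ y ℤ.- x
      eq = solve-∀

    newSum≡top-i : ∀ r → newSum (suc i) r ≡ top-i (suc i ℕ.+ r)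
    newSum≡top-i r = cong (ℤ._- a (suc i ℕ.+ r)) top-i≡

    topSum-window : topSum h (i ℕ.+ h) ≡ top ℤ.- a k ℤ.- a (i ℕ.+ h)
    topSum-window = eq (a k) (a (i ℕ.+ h)) (topSum h (i ℕ.+ h))
      where
      eq : ∀ x y m → m ≡ x ℤ.+ (y ℤ.+ m) ℤ.- x ℤ.- y
      eq = solve-∀

    i+h+2≡k+1 : i ℕ.+ suc (suc h) ≡ suc k
    i+h+2≡k+1 = trans (NP.+-suc i (suc h)) (cong suc (NP.+-suc i h))

    top-minus₂∈ : ∀ p q → i ≤ p → p < q → q ≤ k → (top ℤ.- a p ℤ.- a q) ∈ S± h (suc k)
    top-minus₂∈ p q ip pq qk = subst (λ w → (topSum (suc (suc h)) w ℤ.- a p ℤ.- a q) ∈ S± h w) i+h+2≡k+1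
                          (topSum-minus₂∈S± i h p q ip pq (subst (q <_) (sym i+h+2≡k+1) (s≤s qk)))

    above-old : ∀ z → z ∈ S± h (suc k) → topSum h (i ℕ.+ h) ℤ.< z →
      (Σ[ r ∈ ℕ ] r < h × z ≡ top-k (i ℕ.+ r)) ⊎ (Σ[ r ∈ ℕ ] r < h × z ≡ top-i (suc i ℕ.+ r))
    above-old z zin gt with S±-tight-step (suc i) k<K tight₁ zin
    ... | inj₂ (r , r< , inj₁ e) = inj₂ (r , r< , trans e (newSum≡top-i r))
    ... | inj₂ (r , r< , inj₂ refl) = ⊥-elim (ZP.<-asym (ZP.neg-mono-< (newSum-pos (suc i) r r< k<K))
      (ZP.≤-<-trans (topSum-nonneg h (i ℕ.+ h) (NP.≤-trans (NP.n≤1+n _) (NP.<⇒≤ k<K))) gt))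
    ... | inj₁ w with S±-tight-step-above i (NP.<⇒≤ k<K) tight₀ w gt
    ...   | r , r< , e = inj₁ (r , r< , trans e (newSum≡top-k r))

    ≤k⇒<K : ∀ p → p ≤ k → p < K
    ≤k⇒<K p pk = NP.≤-<-trans pk k<K

    a-<ₖ : ∀ p q → p < q → q ≤ k → a p ℤ.< a q
    a-<ₖ p q pq qk = a-< p q pq (≤k⇒<K q qk)

    a-≤ₖ : ∀ p q → p ≤ q → q ≤ k → a p ℤ.≤ a q
    a-≤ₖ p q pq qk = a-≤ p q pq (≤k⇒<K q qk)

    i+t<K : ∀ t → t ≤ h → i ℕ.+ t < K
    i+t<K t th = ≤k⇒<K (i ℕ.+ t) (NP.≤-trans (NP.+-monoʳ-≤ i th) (NP.n≤1+n _))

    i+h<k : i ℕ.+ h < k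
    i+h<k = NP.n<1+n _

    -- top - a (i+s+1) - a (i+h) is above the old sums but too large for step i+1, so it is
    -- top - a k - a (i+r); r = s follows by induction on s.
    gap-from-last : ∀ s → suc (suc s) ≤ h → a (i ℕ.+ s) ≡ a (i ℕ.+ suc s) ℤ.+ a (i ℕ.+ h) ℤ.- a k
    gap-from-last s s2h = go (above-old e e∈ e>old)
      where
      m : ℕ
      m = i ℕ.+ suc s
      mh : m < i ℕ.+ h
      mh = NP.+-monoʳ-< i s2h
      mk : m ≤ k
      mk = NP.<⇒≤ (NP.<-trans mh i+h<k)
      e : ℤ
      e = top ℤ.- a m ℤ.- a (i ℕ.+ h)
      e∈ : e ∈ S± h (suc k)
      e∈ = top-minus₂∈ m (i ℕ.+ h) (NP.m≤m+n i (suc s)) mh (NP.n≤1+n _)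
      e>old : topSum h (i ℕ.+ h) ℤ.< e
      e>old = subst (ℤ._< e) (sym topSum-window) (<-via-gap _ _ (a k ℤ.- a m) (eq top (a k) (a m) (a (i ℕ.+ h))) (i<j⇒0<j-i (a-<ₖ m k (NP.<-trans mh i+h<k) NP.≤-refl)))
        where
        eq : ∀ w x y z → w ℤ.- y ℤ.- z ≡ w ℤ.- x ℤ.- z ℤ.+ (x ℤ.- y)
        eq = solve-∀
      go : (Σ[ r ∈ ℕ ] r < h × e ≡ top-k (i ℕ.+ r)) ⊎ (Σ[ r ∈ ℕ ] r < h × e ≡ top-i (suc i ℕ.+ r)) →
           a (i ℕ.+ s) ≡ a m ℤ.+ a (i ℕ.+ h) ℤ.- a k
      go (inj₂ (r , r< , ed)) = ⊥-elim (ZP.<-irrefl ed (<-via-gap e (top-i (suc i ℕ.+ r))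
                                  ((a (i ℕ.+ h) ℤ.- a (suc i ℕ.+ r)) ℤ.+ (a m ℤ.- a i)) (eq top (a i) (a (suc i ℕ.+ r)) (a m) (a (i ℕ.+ h)))
                                  (ZP.+-mono-≤-< (ZP.i≤j⇒0≤j-i (a-≤ₖ (suc i ℕ.+ r) (i ℕ.+ h) (NP.+-monoʳ-< i r<) (NP.n≤1+n _)))
                                                 (i<j⇒0<j-i (a-<ₖ i m (NP.m<m+n i (s≤s z≤n)) mk)))))
        where
        eq : ∀ w x y z u → w ℤ.- x ℤ.- y ≡ w ℤ.- z ℤ.- u ℤ.+ ((u ℤ.- y) ℤ.+ (z ℤ.- x))
        eq = solve-∀
      go (inj₁ (r , r< , ec)) = by-cases-on-s s refl
        where
        ar : a (i ℕ.+ r) ≡ a m ℤ.+ a (i ℕ.+ h) ℤ.- a k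
        ar = i-j-k≡i-l-m⇒m≡j+k-l top (a m) (a (i ℕ.+ h)) (a k) (a (i ℕ.+ r)) ec
        rk : i ℕ.+ r ≤ k
        rk = NP.<⇒≤ (NP.<-trans (NP.+-monoʳ-< i r<) i+h<k)
        r<s1 : r < suc s
        r<s1 = NP.+-cancelˡ-< i r (suc s) (a-<⁻ (i ℕ.+ r) m (≤k⇒<K _ rk) (≤k⇒<K m mk)
          (subst (ℤ._< a m) (sym ar) (i+j-k<i (a m) (a (i ℕ.+ h)) (a k) (a-<ₖ (i ℕ.+ h) k i+h<k NP.≤-refl))))
        by-cases-on-s : ∀ s' → s' ≡ s → a (i ℕ.+ s) ≡ a m ℤ.+ a (i ℕ.+ h) ℤ.- a k
        by-cases-on-s zero refl with r<s1
        ... | s≤s z≤n = trans (cong a (NP.+-identityʳ i)) (trans (cong a (sym (NP.+-identityʳ i))) ar)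
        by-cases-on-s (suc s') refl = subst (λ t → a (i ℕ.+ t) ≡ a m ℤ.+ a (i ℕ.+ h) ℤ.- a k) rs ar
          where
          ih : a (i ℕ.+ s') ≡ a (i ℕ.+ suc s') ℤ.+ a (i ℕ.+ h) ℤ.- a k
          ih = gap-from-last s' (NP.≤-trans (NP.n≤1+n _) s2h)
          gt' : a (i ℕ.+ s') ℤ.< a (i ℕ.+ r)
          gt' = subst₂ ℤ._<_ (sym ih) (sym ar) (ZP.+-monoˡ-< (- a k) (ZP.+-monoˡ-< (a (i ℕ.+ h)) (a-<ₖ (i ℕ.+ suc s') m (NP.+-monoʳ-< i (NP.n<1+n _)) mk)))
          s'<r : s' < r
          s'<r = NP.+-cancelˡ-< i s' r (a-<⁻ (i ℕ.+ s') (i ℕ.+ r) (i+t<K s' (NP.≤-trans (NP.m≤n+m s' 3) s2h)) (≤k⇒<K _ rk) gt')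
          rs : r ≡ suc s'
          rs = squeeze s' r s'<r r<s1

    g : ℤ
    g = gap i

    i<k : i < k
    i<k = s≤s (NP.m≤m+n i h)

    -- top - a (i+1) - a m is a new sum: as one of step i+1 it exhibits a m + g, as one of step i it
    -- forces a k = a m + g.
    shift-by-g : ∀ m → suc (suc i) ≤ m → m ≤ i ℕ.+ h → Σ[ j ∈ ℕ ] j ≤ k × a j ≡ a m ℤ.+ g
    shift-by-g m im mh = go (above-old e e∈ e>old)
      where
      mk : m < k
      mk = s≤s mh
      e : ℤ
      e = top ℤ.- a (suc i) ℤ.- a m
      e∈ : e ∈ S± h (suc k)
      e∈ = top-minus₂∈ (suc i) m (NP.n≤1+n i) im (NP.<⇒≤ mk)
      e>old : topSum h (i ℕ.+ h) ℤ.< e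
      e>old = subst (ℤ._< e) (sym topSum-window) (<-via-gap _ _ ((a k ℤ.- a m) ℤ.+ (a (i ℕ.+ h) ℤ.- a (suc i))) (eq top (a k) (a (i ℕ.+ h)) (a (suc i)) (a m))
              (ZP.+-mono-<-≤ (i<j⇒0<j-i (a-<ₖ m k mk NP.≤-refl)) (ZP.i≤j⇒0≤j-i (a-≤ₖ (suc i) (i ℕ.+ h) (NP.≤-trans (NP.n≤1+n _) (NP.≤-trans im mh)) (NP.n≤1+n _)))))
        where
        eq : ∀ w x y z u → w ℤ.- z ℤ.- u ≡ w ℤ.- x ℤ.- y ℤ.+ ((x ℤ.- u) ℤ.+ (y ℤ.- z))
        eq = solve-∀
      go : (Σ[ r ∈ ℕ ] r < h × e ≡ top-k (i ℕ.+ r)) ⊎ (Σ[ r ∈ ℕ ] r < h × e ≡ top-i (suc i ℕ.+ r)) →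
           Σ[ j ∈ ℕ ] j ≤ k × a j ≡ a m ℤ.+ g
      go (inj₂ (r , r< , ed)) = suc i ℕ.+ r , NP.<⇒≤ (s≤s (NP.+-monoʳ-< i r<)) ,
           trans (i-j-k≡i-l-m⇒m≡j+k-l top (a (suc i)) (a m) (a i) (a (suc i ℕ.+ r)) ed) (eq (a (suc i)) (a m) (a i))
        where
        eq : ∀ x y z → x ℤ.+ y ℤ.- z ≡ y ℤ.+ (x ℤ.- z)
        eq = solve-∀
      go (inj₁ (r , r< , ec)) = k , NP.≤-refl , akeq
        where
        ar : a (i ℕ.+ r) ≡ a (suc i) ℤ.+ a m ℤ.- a k
        ar = i-j-k≡i-l-m⇒m≡j+k-l top (a (suc i)) (a m) (a k) (a (i ℕ.+ r)) ec
        rk : i ℕ.+ r ≤ k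
        rk = NP.<⇒≤ (NP.<-trans (NP.+-monoʳ-< i r<) i+h<k)
        r0 : i ℕ.+ r < suc i
        r0 = a-<⁻ (i ℕ.+ r) (suc i) (≤k⇒<K _ rk) (≤k⇒<K (suc i) i<k) (subst (ℤ._< a (suc i)) (sym ar) (i+j-k<i (a (suc i)) (a m) (a k) (a-<ₖ m k mk NP.≤-refl)))
        ir : i ℕ.+ r ≡ i
        ir = NP.≤-antisym (NP.≤-pred r0) (NP.m≤m+n i r)
        akeq : a k ≡ a m ℤ.+ g
        akeq = trans (eq (a (suc i)) (a m) (a k)) (cong (λ w → a m ℤ.+ (a (suc i) ℤ.- w)) (sym (trans (sym (cong a ir)) ar)))
          where
          eq : ∀ x y z → z ≡ y ℤ.+ (x ℤ.- (x ℤ.+ y ℤ.- z))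
          eq = solve-∀

    g>0 : 0ℤ ℤ.< g
    g>0 = i<j⇒0<j-i (a-<ₖ i (suc i) (NP.n<1+n i) i<k)

    gap-from-first : ∀ u t → u ℕ.+ t ℕ.+ 2 ≡ h → a (suc (i ℕ.+ (2 ℕ.+ t))) ≡ a (i ℕ.+ (2 ℕ.+ t)) ℤ.+ g
    gap-from-first u t eqh = fin (shift-by-g m im mh)
      where
      m : ℕ
      m = i ℕ.+ (2 ℕ.+ t)
      im : suc (suc i) ≤ m
      im = subst (ℕ._≤ m) (NP.+-comm i 2) (NP.+-monoʳ-≤ i (NP.m≤m+n 2 t))
      t2h : 2 ℕ.+ t ≤ h
      t2h = subst (2 ℕ.+ t ≤_) eqh (subst (ℕ._≤ u ℕ.+ t ℕ.+ 2) (NP.+-comm t 2) (subst (t ℕ.+ 2 ≤_) (sym (NP.+-assoc u t 2)) (NP.m≤n+m (t ℕ.+ 2) u)))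
      mh : m ≤ i ℕ.+ h
      mh = NP.+-monoʳ-≤ i t2h
      upper : ∀ u → u ℕ.+ t ℕ.+ 2 ≡ h → ∀ j → j ≤ k → a j ≡ a m ℤ.+ g → j < suc (suc m)
      upper zero e j jk aj = s≤s (subst (j ≤_) (cong suc (sym (cong (i ℕ.+_) (trans (NP.+-comm 2 t) e)))) jk)
      upper (suc u') e j jk aj = a-<⁻ j (suc (suc m)) (≤k⇒<K j jk) (≤k⇒<K (suc (suc m)) ssmk) lt
        where
        e' : u' ℕ.+ suc t ℕ.+ 2 ≡ h
        e' = trans (cong (ℕ._+ 2) (NP.+-suc u' t)) e
        ih : a (suc (i ℕ.+ (2 ℕ.+ suc t))) ≡ a (i ℕ.+ (2 ℕ.+ suc t)) ℤ.+ g
        ih = gap-from-first u' (suc t) e'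
        m' : i ℕ.+ (2 ℕ.+ suc t) ≡ suc m
        m' = NP.+-suc i (2 ℕ.+ t)
        ih' : a (suc (suc m)) ≡ a (suc m) ℤ.+ g
        ih' = subst (λ w → a (suc w) ≡ a w ℤ.+ g) m' ih
        t3h : 2 ℕ.+ suc t ≤ h
        t3h = subst (2 ℕ.+ suc t ≤_) e' (subst (ℕ._≤ u' ℕ.+ suc t ℕ.+ 2) (NP.+-comm (suc t) 2) (subst (suc t ℕ.+ 2 ≤_) (sym (NP.+-assoc u' (suc t) 2)) (NP.m≤n+m (suc t ℕ.+ 2) u')))
        ssmk : suc (suc m) ≤ k
        ssmk = s≤s (subst (ℕ._≤ i ℕ.+ h) m' (NP.+-monoʳ-≤ i t3h))
        lt : a j ℤ.< a (suc (suc m))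
        lt = subst₂ ℤ._<_ (sym aj) (sym ih') (ZP.+-monoˡ-< g (a-<ₖ m (suc m) (NP.n<1+n m) (NP.<⇒≤ ssmk)))
      fin : (Σ[ j ∈ ℕ ] j ≤ k × a j ≡ a m ℤ.+ g) → a (suc m) ≡ a m ℤ.+ g
      fin (j , jk , aj) = subst (λ w → a w ≡ a m ℤ.+ g) (squeeze m j lo (upper u eqh j jk aj)) aj
        where
        lo : m < j
        lo = a-<⁻ m j (≤k⇒<K m (NP.≤-trans mh (NP.n≤1+n _))) (≤k⇒<K j jk) (subst (a m ℤ.<_) (sym aj) (<-via-gap (a m) (a m ℤ.+ g) g refl g>0))

    window-gaps : ∀ t → t ≤ h → gap (i ℕ.+ t) ≡ gap i
    window-gaps zero _ = cong gap (NP.+-identityʳ i)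
    window-gaps (suc zero) _ = begin
      gap (i ℕ.+ 1)                           ≡⟨ cong (λ m → a m ℤ.- a (i ℕ.+ 1)) (sym (NP.+-suc i 1)) ⟩
      a (i ℕ.+ 2) ℤ.- a (i ℕ.+ 1)             ≡⟨ gap≡last 1 3≤h ⟩
      a k ℤ.- a (i ℕ.+ h)                     ≡⟨ sym (gap≡last 0 (NP.≤-trans (NP.n≤1+n 2) 3≤h)) ⟩
      a (i ℕ.+ 1) ℤ.- a (i ℕ.+ 0)             ≡⟨ cong₂ (λ u v → a u ℤ.- a v) (NP.+-comm i 1) (NP.+-identityʳ i) ⟩
      gap i                                   ∎
      where
      open ≡-Reasoning
      gap≡last : ∀ s → suc (suc s) ≤ h → a (i ℕ.+ suc s) ℤ.- a (i ℕ.+ s) ≡ a k ℤ.- a (i ℕ.+ h)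
      gap≡last s s+2≤h = trans (cong (λ x → a (i ℕ.+ suc s) ℤ.- x) (gap-from-last s s+2≤h)) (eq (a (i ℕ.+ suc s)) (a (i ℕ.+ h)) (a k))
        where
        eq : ∀ x y z → x ℤ.- (x ℤ.+ y ℤ.- z) ≡ z ℤ.- y
        eq = solve-∀
    window-gaps (suc (suc t)) t+2≤h = begin
      gap (i ℕ.+ (2 ℕ.+ t))                   ≡⟨ cong (ℤ._- a (i ℕ.+ (2 ℕ.+ t))) (gap-from-first (h ∸ (2 ℕ.+ t)) t rest) ⟩
      a (i ℕ.+ (2 ℕ.+ t)) ℤ.+ g ℤ.- a (i ℕ.+ (2 ℕ.+ t)) ≡⟨ eq (a (i ℕ.+ (2 ℕ.+ t))) g ⟩
      gap i                                   ∎
      where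
      open ≡-Reasoning
      rest : h ∸ (2 ℕ.+ t) ℕ.+ t ℕ.+ 2 ≡ h
      rest = trans (NP.+-assoc (h ∸ (2 ℕ.+ t)) t 2) (trans (cong (h ∸ (2 ℕ.+ t) ℕ.+_) (NP.+-comm t 2)) (NP.m∸n+n≡m t+2≤h))
      eq : ∀ x y → x ℤ.+ y ℤ.- x ≡ y
      eq = solve-∀

  module _ (tight : ∀ j → 1 ≤ j → suc (j ℕ.+ h) ≤ K → TightStep j) where

    private
      window-gaps : ∀ i → 1 ≤ i → suc (suc (i ℕ.+ h)) ≤ K → ∀ t → t ≤ h → gap (i ℕ.+ t) ≡ gap i
      window-gaps i 1≤i k<K = Window.window-gaps i k<K (tight i 1≤i (NP.<⇒≤ k<K)) (tight (suc i) (s≤s z≤n) k<K)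

    gaps-constant : ∀ i → suc (suc (suc i ℕ.+ h)) ≤ K → ∀ j → 1 ≤ j → j ≤ suc i ℕ.+ h → gap j ≡ gap 1
    gaps-constant zero k<K (suc t) _ (s≤s t≤h) = window-gaps 1 (s≤s z≤n) k<K t t≤h
    gaps-constant (suc i) k<K j 1≤j j≤ with NP.m≤n⇒m<n∨m≡n j≤
    ... | inj₁ j< = gaps-constant i (NP.<⇒≤ k<K) j 1≤j (NP.≤-pred j<)
    ... | inj₂ refl = trans (window-gaps (suc (suc i)) (s≤s z≤n) k<K h NP.≤-refl)
      (gaps-constant i (NP.<⇒≤ k<K) (suc (suc i)) (s≤s z≤n) (s≤s (subst (_≤ i ℕ.+ h) (NP.+-comm i 1) (NP.+-monoʳ-≤ i (NP.≤-trans (s≤s z≤n) 3≤h)))))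

    AP-from-1 : suc (suc (suc h)) ≤ K → ∀ j → suc j < K → a (suc j) ≡ a 1 ℤ.+ gap 1 ℤ.* + j
    AP-from-1 h+3≤K zero _ = sym (trans (cong (λ x → a 1 ℤ.+ x) (ZP.*-zeroʳ (gap 1))) (ZP.+-identityʳ (a 1)))
    AP-from-1 h+3≤K (suc j) j+2<K = begin
      a (suc (suc j))                          ≡⟨ eq₁ (a (suc (suc j))) (a (suc j)) ⟩
      a (suc j) ℤ.+ gap (suc j)                ≡⟨ cong₂ ℤ._+_ (AP-from-1 h+3≤K j (NP.<-trans (NP.n<1+n _) j+2<K)) gap≡ ⟩
      a 1 ℤ.+ gap 1 ℤ.* + j ℤ.+ gap 1          ≡⟨ eq₂ (a 1) (gap 1) (+ j) ⟩
      a 1 ℤ.+ gap 1 ℤ.* (+ 1 ℤ.+ + j)          ∎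
      where
      open ≡-Reasoning
      eq₁ : ∀ x y → x ≡ y ℤ.+ (x ℤ.- y)
      eq₁ = solve-∀
      eq₂ : ∀ x d y → x ℤ.+ d ℤ.* y ℤ.+ d ≡ x ℤ.+ d ℤ.* (+ 1 ℤ.+ y)
      eq₂ = solve-∀
      -- the largest window, starting at K - (h+2), reaches the last gap
      r : ℕ
      r = K ∸ (3 ℕ.+ h)
      K≡ : 3 ℕ.+ h ℕ.+ r ≡ K
      K≡ = NP.m+[n∸m]≡n h+3≤K
      gap≡ : gap (suc j) ≡ gap 1
      gap≡ = gaps-constant r (NP.≤-reflexive (trans (cong (λ x → 3 ℕ.+ x) (NP.+-comm r h)) K≡)) (suc j) (s≤s z≤n)
        (NP.≤-pred (NP.≤-pred (subst (suc (suc (suc j)) ≤_) (trans (sym K≡) (eq₃ h r)) j+2<K)))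
        where
        eq₃ : ∀ h r → 3 ℕ.+ h ℕ.+ r ≡ 2 ℕ.+ (suc r ℕ.+ h)
        eq₃ = ℕ-solve-∀

multiple-below⇒0 : ∀ d q → 0ℤ ℤ.< d → 0ℤ ℤ.≤ d ℤ.* q → d ℤ.* q ℤ.< d → q ≡ 0ℤ
multiple-below⇒0 d q 0<d 0≤dq dq<d = between-0-and-1 q
  (ZP.*-cancelˡ-≤-pos 0ℤ q d {{ℤ.positive 0<d}} (subst (ℤ._≤ d ℤ.* q) (sym (ZP.*-zeroʳ d)) 0≤dq))
  (ZP.*-cancelˡ-<-nonNeg d {{ℤ.nonNegative (ZP.<⇒≤ 0<d)}} (subst (d ℤ.* q ℤ.<_) (sym (ZP.*-identityʳ d)) dq<d))
  where
  between-0-and-1 : ∀ q → 0ℤ ℤ.≤ q → q ℤ.< + 1 → q ≡ 0ℤ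
  between-0-and-1 (+ zero) _ _ = refl
  between-0-and-1 +[1+ _ ] _ (ℤ.+<+ (s≤s ()))

-- For k = h + 2 there is a single step.  A tight start means that every old sum is a stair value, a
-- multiple of d = a 1.  A tight step puts x = a (h+1) at most a 1 + a h (otherwise top - a 1 - a h
-- would be a new sum it cannot be), and the sum x - (a 1 + ⋯ + a (h-1)) is then an old sum, so x is a
-- multiple of d in (a h , a h + d].
module NextTerm (n : ℕ) (a : ℕ → ℤ) (a0 : a 0 ≡ 0ℤ)
                (a-step : ∀ i → suc i < suc (suc (stairHeight n)) → a i ℤ.< a (suc i))
                (a-AP : ∀ j → j ≤ stairHeight n → a j ≡ a 1 ℤ.* + j)
                (start-tight : card (Prefix.S± a (stairHeight n) (suc (stairHeight n))) ≤ stairLength n)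
                (step-tight : Increasing.Growth.TightStep a (suc (suc (stairHeight n))) a0 a-step (stairHeight n) 1) where

  open Increasing a (suc (suc (stairHeight n))) a0 a-step
  open Growth (stairHeight n)

  private
    d : ℤ
    d = a 1
    x : ℤ
    x = a (suc (stairHeight n))
    oldMax : ℤ
    oldMax = topSum (stairHeight n) (suc (stairHeight n))

  d>0 : 0ℤ ℤ.< d
  d>0 = a-pos 1 (s≤s z≤n) (s≤s (s≤s z≤n))

  a-AP′ : ∀ j → j < stairHeight n → a (suc j) ≡ d ℤ.+ d ℤ.* + j
  a-AP′ j j<h = trans (a-AP (suc j) j<h) (eq d (+ j))
    where
    eq : ∀ d y → d ℤ.* (+ 1 ℤ.+ y) ≡ d ℤ.+ d ℤ.* y
    eq = solve-∀

  open APStaircase a a0 d d (stairHeight n) a-AP′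
  open Values n NP.≤-refl d>0 d>0

  top≡ : topSum (suc (suc (stairHeight n))) (suc (suc (stairHeight n))) ≡ x ℤ.+ oldMax
  top≡ = cong (λ t → x ℤ.+ t) (trans (topSum-suc (stairHeight n) (suc (stairHeight n)) NP.≤-refl)
    (trans (cong (λ j → oldMax ℤ.+ a j) (NP.n∸n≡0 (suc (stairHeight n)))) (trans (cong (λ t → oldMax ℤ.+ t) a0) (ZP.+-identityʳ oldMax))))

  x≤a₁+aₕ : x ℤ.≤ a 1 ℤ.+ a (stairHeight n)
  x≤a₁+aₕ = ≤-via-gap x _ (oldMax ℤ.- y) (trans (eq x oldMax (a 1) (a (stairHeight n))) (cong (λ w → x ℤ.+ (oldMax ℤ.- (w ℤ.- a 1 ℤ.- a (stairHeight n)))) (sym top≡)))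
    (ZP.i≤j⇒0≤j-i y≤oldMax)
    where
    y : ℤ
    y = topSum (suc (suc (stairHeight n))) (suc (suc (stairHeight n))) ℤ.- a 1 ℤ.- a (stairHeight n)
    y∈ : y ∈ S± (stairHeight n) (suc (suc (stairHeight n)))
    y∈ = topSum-minus₂∈S± 0 (stairHeight n) 1 (stairHeight n) z≤n (NP.≤-trans (s≤s (s≤s z≤n)) (NP.m≤m+n 4 n))
      (NP.<-trans (NP.n<1+n (stairHeight n)) (NP.n<1+n (suc (stairHeight n))))
    y≤oldMax : y ℤ.≤ oldMax
    y≤oldMax with y ZP.≤? oldMax
    ... | yes y≤ = y≤
    ... | no y≰ with S±-tight-step-above 1 NP.≤-refl step-tight y∈ (ZP.≰⇒> y≰)
    ...   | r , r<h , y≡ = ⊥-elim (ZP.<-irrefl a₁₊ᵣ≡ a₁₊ᵣ<)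
      where
      a₁₊ᵣ≡ : a (suc r) ≡ a 1 ℤ.+ a (stairHeight n)
      a₁₊ᵣ≡ = i-j-k≡i-l⇒l≡j+k (x ℤ.+ oldMax) (a 1) (a (stairHeight n)) (a (suc r)) (trans (cong (λ w → w ℤ.- a 1 ℤ.- a (stairHeight n)) (sym top≡)) y≡)
      a₁₊ᵣ< : a (suc r) ℤ.< a 1 ℤ.+ a (stairHeight n)
      a₁₊ᵣ< = ZP.≤-<-trans (a-≤ (suc r) (stairHeight n) r<h (NP.<-trans (NP.n<1+n (stairHeight n)) (NP.n<1+n (suc (stairHeight n)))))
        (<-via-gap (a (stairHeight n)) (a 1 ℤ.+ a (stairHeight n)) (a 1) (ZP.+-comm (a 1) (a (stairHeight n))) d>0)
    eq : ∀ x s u v → u ℤ.+ v ≡ x ℤ.+ (s ℤ.- (x ℤ.+ s ℤ.- u ℤ.- v))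
    eq = solve-∀

  private
    lowSum : ℤ
    lowSum = topSum (3 ℕ.+ n) (stairHeight n)
    z : ℤ
    z = x ℤ.+ (- lowSum)

  z∈old : z ∈ S± (stairHeight n) (suc (stairHeight n))
  z∈old = S±-tight-step-within 1 NP.≤-refl step-tight z∈ z≤oldMax -oldMax≤z
    where
    z∈ : z ∈ S± (stairHeight n) (suc (suc (stairHeight n)))
    z∈ = S±-add (3 ℕ.+ n) (suc (stairHeight n)) (S±-extend (3 ℕ.+ n) (stairHeight n) (S±-neg (3 ℕ.+ n) (stairHeight n) (topSum∈S± 1 (3 ℕ.+ n))))
    a₁≤lowSum : a 1 ℤ.≤ lowSum
    a₁≤lowSum = subst (a 1 ℤ.≤_) (sym (trans (topSum-suc (2 ℕ.+ n) (stairHeight n) (NP.n≤1+n _))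
                                             (cong (λ j → topSum (2 ℕ.+ n) (stairHeight n) ℤ.+ a j) (NP.m+n∸n≡m 1 n))))
      (≤-via-gap (a 1) _ (topSum (2 ℕ.+ n) (stairHeight n)) (ZP.+-comm (topSum (2 ℕ.+ n) (stairHeight n)) (a 1))
        (topSum-nonneg (2 ℕ.+ n) (stairHeight n) (NP.≤-trans (NP.n≤1+n (stairHeight n)) (NP.n≤1+n (suc (stairHeight n))))))
    z≤oldMax : z ℤ.≤ oldMax
    z≤oldMax = ≤-via-gap z oldMax (((a 1 ℤ.+ a (stairHeight n)) ℤ.- x) ℤ.+ (lowSum ℤ.- a 1) ℤ.+ lowSum) (eq x (a 1) (a (stairHeight n)) lowSum)
      (ZP.+-mono-≤ (ZP.+-mono-≤ (ZP.i≤j⇒0≤j-i x≤a₁+aₕ) (ZP.i≤j⇒0≤j-i a₁≤lowSum)) (ZP.≤-trans (ZP.<⇒≤ d>0) a₁≤lowSum))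
      where
      eq : ∀ x u v m → v ℤ.+ m ≡ x ℤ.+ (- m) ℤ.+ ((u ℤ.+ v) ℤ.- x ℤ.+ (m ℤ.- u) ℤ.+ m)
      eq = solve-∀
    -oldMax≤z : (- oldMax) ℤ.≤ z
    -oldMax≤z = ≤-via-gap (- oldMax) z (x ℤ.+ a (stairHeight n)) (eq x (a (stairHeight n)) lowSum)
      (ZP.+-mono-≤ (a-nonneg (suc (stairHeight n)) (NP.n<1+n (suc (stairHeight n)))) (a-nonneg (stairHeight n) (NP.<-trans (NP.n<1+n (stairHeight n)) (NP.n<1+n (suc (stairHeight n))))))
      where
      eq : ∀ x v m → x ℤ.+ (- m) ≡ (- (v ℤ.+ m)) ℤ.+ (x ℤ.+ v)
      eq = solve-∀

  topSum-multiple : ∀ g k → k ≤ suc (stairHeight n) → Σ[ q ∈ ℤ ] topSum g k ≡ d ℤ.* q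
  topSum-multiple zero k _ = 0ℤ , sym (ZP.*-zeroʳ d)
  topSum-multiple (suc g) zero _ = 0ℤ , sym (ZP.*-zeroʳ d)
  topSum-multiple (suc g) (suc k) (s≤s k≤h) with topSum-multiple g k (NP.≤-trans k≤h (NP.n≤1+n (stairHeight n)))
  ... | q , e = + k ℤ.+ q , trans (cong₂ ℤ._+_ (a-AP k k≤h) e) (sym (ZP.*-distribˡ-+ d (+ k) q))

  next-term : a (suc (stairHeight n)) ≡ d ℤ.* + suc (stairHeight n)
  next-term = begin
    x                                     ≡⟨ eq₁ x (a 1 ℤ.+ a (stairHeight n)) ⟩
    a 1 ℤ.+ a (stairHeight n) ℤ.- (a 1 ℤ.+ a (stairHeight n) ℤ.- x)   ≡⟨ cong (λ w → a 1 ℤ.+ a (stairHeight n) ℤ.- w) (trans gap≡ (cong (d ℤ.*_) q≡0)) ⟩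
    a 1 ℤ.+ a (stairHeight n) ℤ.- d ℤ.* 0ℤ              ≡⟨ cong (λ w → a 1 ℤ.+ w ℤ.- d ℤ.* 0ℤ) (a-AP (stairHeight n) NP.≤-refl) ⟩
    d ℤ.+ d ℤ.* + stairHeight n ℤ.- d ℤ.* 0ℤ          ≡⟨ eq₂ d (+ (stairHeight n)) ⟩
    d ℤ.* + suc (stairHeight n)                         ∎
    where
    -- no `with` here: abstracting over the module parameters would unfold their signed sums
    on-stair : Σ[ p ∈ ℕ ] p < stairLength n × z ≡ stairValue p
    on-stair = stair-card-tight start-tight z∈old
    p : ℕ
    p = proj₁ on-stair
    z≡ : z ≡ stairValue p
    z≡ = proj₂ (proj₂ on-stair)
    lowSum-multiple : Σ[ q ∈ ℤ ] lowSum ≡ d ℤ.* q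
    lowSum-multiple = topSum-multiple (3 ℕ.+ n) (stairHeight n) (NP.n≤1+n (stairHeight n))
    q′ : ℤ
    q′ = proj₁ lowSum-multiple
    lowSum≡ : lowSum ≡ d ℤ.* q′
    lowSum≡ = proj₂ lowSum-multiple
    open ≡-Reasoning
    eq₁ : ∀ x w → x ≡ w ℤ.- (w ℤ.- x)
    eq₁ = solve-∀
    eq₂ : ∀ d y → d ℤ.+ d ℤ.* y ℤ.- d ℤ.* 0ℤ ≡ d ℤ.* (+ 1 ℤ.+ y)
    eq₂ = solve-∀
    q : ℤ
    q = + 1 ℤ.+ + stairHeight n ℤ.- (stairM n p ℤ.+ stairT n p ℤ.+ q′)
    gap≡ : a 1 ℤ.+ a (stairHeight n) ℤ.- x ≡ d ℤ.* q
    gap≡ = begin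
      a 1 ℤ.+ a (stairHeight n) ℤ.- x                                  ≡⟨ cong₂ (λ u w → a 1 ℤ.+ u ℤ.- w) (a-AP (stairHeight n) NP.≤-refl) (eq₃ x lowSum) ⟩
      d ℤ.+ d ℤ.* + stairHeight n ℤ.- (z ℤ.+ lowSum)                 ≡⟨ cong₂ (λ u w → d ℤ.+ d ℤ.* + stairHeight n ℤ.- (u ℤ.+ w)) z≡ lowSum≡ ⟩
      d ℤ.+ d ℤ.* + stairHeight n ℤ.- (stairValue p ℤ.+ d ℤ.* q′)    ≡⟨ eq₄ d (+ (stairHeight n)) (stairM n p) (stairT n p) q′ ⟩
      d ℤ.* q                                            ∎
      where
      eq₃ : ∀ x m → x ≡ x ℤ.+ (- m) ℤ.+ m
      eq₃ = solve-∀
      eq₄ : ∀ d y u w r → d ℤ.+ d ℤ.* y ℤ.- (d ℤ.* u ℤ.+ d ℤ.* w ℤ.+ d ℤ.* r) ≡ d ℤ.* ((+ 1) ℤ.+ y ℤ.- (u ℤ.+ w ℤ.+ r))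
      eq₄ = solve-∀
    q≡0 : q ≡ 0ℤ
    q≡0 = multiple-below⇒0 d q d>0 (subst (0ℤ ℤ.≤_) gap≡ (ZP.i≤j⇒0≤j-i x≤a₁+aₕ))
      (subst (ℤ._< d) gap≡ (<-via-gap (a 1 ℤ.+ a (stairHeight n) ℤ.- x) d (x ℤ.- a (stairHeight n)) (eq₅ (a 1) (a (stairHeight n)) x)
        (i<j⇒0<j-i (a-step (stairHeight n) (NP.n<1+n (suc (stairHeight n)))))))
      where
      eq₅ : ∀ u v x → u ≡ u ℤ.+ v ℤ.- x ℤ.+ (x ℤ.- v)
      eq₅ = solve-∀

DilatedRange : (ℕ → ℤ) → ℕ → Set
DilatedRange a N = ∀ j → j < N → a j ≡ a 1 ℤ.* + j

applyUpTo-injective : ∀ (f g : ℕ → ℤ) n → applyUpTo f n ≡ applyUpTo g n → ∀ j → j < n → f j ≡ g j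
applyUpTo-injective f g (suc n) e zero _ = LP.∷-injectiveˡ e
applyUpTo-injective f g (suc n) e (suc j) (s≤s j<n) =
  applyUpTo-injective (λ x → f (suc x)) (λ x → g (suc x)) n (LP.∷-injectiveʳ e) j j<n

take-applyUpTo : ∀ (f : ℕ → ℤ) m k → m ≤ k → take m (applyUpTo f k) ≡ applyUpTo f m
take-applyUpTo f zero k _ = refl
take-applyUpTo f (suc m) (suc k) (s≤s m≤k) = cong (f 0 ∷_) (take-applyUpTo (λ x → f (suc x)) m k m≤k)

IsAP-applyUpTo⁻ : ∀ (f : ℕ → ℤ) n → IsAP (applyUpTo f n) → Σ[ c ∈ ℤ ] Σ[ d ∈ ℤ ] (∀ j → j < n → f j ≡ c ℤ.+ d ℤ.* + j)
IsAP-applyUpTo⁻ f n (c , d , f≡) = c , d , applyUpTo-injective f (λ j → c ℤ.+ d ℤ.* + j) n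
  (trans f≡ (trans (cong (λ m → map (λ j → c ℤ.+ d ℤ.* + j) (upTo m)) (LP.length-applyUpTo f n)) (LP.map-upTo _ n)))

module _ (a : ℕ → ℤ) (a0 : a 0 ≡ 0ℤ) where

  dilation-of-AP : ∀ N c d → 1 < N → (∀ j → j < N → a j ≡ c ℤ.+ d ℤ.* + j) → DilatedRange a N
  dilation-of-AP N c d 1<N a-AP j j<N =
    trans (a-AP j j<N) (trans (cong₂ (λ u v → u ℤ.+ v ℤ.* + j) c≡0 (sym a₁≡d)) (ZP.+-identityˡ _))
    where
    c≡0 : c ≡ 0ℤ
    c≡0 = trans (sym (trans (a-AP 0 (NP.<-trans (s≤s z≤n) 1<N)) (trans (cong (λ x → c ℤ.+ x) (ZP.*-zeroʳ d)) (ZP.+-identityʳ c)))) a0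
    a₁≡d : a 1 ≡ d
    a₁≡d = trans (a-AP 1 1<N) (trans (cong₂ ℤ._+_ c≡0 (ZP.*-identityʳ d)) (ZP.+-identityˡ d))

  dilation-of-AP′ : ∀ N c → 1 < N → (∀ j → suc j < N → a (suc j) ≡ c ℤ.+ c ℤ.* + j) → DilatedRange a N
  dilation-of-AP′ N c 1<N a-AP zero _ = trans a0 (sym (ZP.*-zeroʳ (a 1)))
  dilation-of-AP′ N c 1<N a-AP (suc j) j<N = trans (a-AP j j<N) (trans (eq c (+ j)) (cong (ℤ._* + suc j) (sym a₁≡c)))
    where
    eq : ∀ c y → c ℤ.+ c ℤ.* y ≡ c ℤ.* (+ 1 ℤ.+ y)
    eq = solve-∀
    a₁≡c : a 1 ≡ c
    a₁≡c = trans (a-AP 0 1<N) (trans (cong (λ x → c ℤ.+ x) (ZP.*-zeroʳ c)) (ZP.+-identityʳ c))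

  elems-dilation : ∀ N → DilatedRange a N →
    ∀ z → (z ∈ elems a N → ∃[ j ] (j < N × z ≡ a 1 ℤ.* + j)) × ((∃[ j ] (j < N × z ≡ a 1 ℤ.* + j)) → z ∈ elems a N)
  elems-dilation N dilated z = to , from
    where
    to : z ∈ elems a N → ∃[ j ] (j < N × z ≡ a 1 ℤ.* + j)
    to z∈ with MP.∈-map⁻ a z∈
    ... | j , j∈ , z≡aj = j , MP.∈-upTo⁻ j∈ , trans z≡aj (dilated j (MP.∈-upTo⁻ j∈))
    from : (∃[ j ] (j < N × z ≡ a 1 ℤ.* + j)) → z ∈ elems a N
    from (j , j<N , z≡) = subst (_∈ elems a N) (trans (dilated j j<N) (sym z≡)) (MP.∈-map⁺ a (MP.∈-upTo⁺ j<N))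

-- The theorem for h = 4 + m and k = K = n + h + 1.  The explicit stairHeight m (rather than an
-- abbreviation for h) keeps the card terms syntactically equal across modules: otherwise the type
-- checker unfolds the signed sums of the concrete prefix lists to compare them.
module Extremal (m n K : ℕ) (K≡ : K ≡ suc (n ℕ.+ stairHeight m)) (a : ℕ → ℤ) (a0 : a 0 ≡ 0ℤ)
                (a-step : ∀ i → suc i < K → a i ℤ.< a (suc i))
                (card≡ : card (stairHeight m ^∧± elems a K)
                         ≡ (2 ℕ.* stairHeight m ℕ.* K ∸ stairHeight m ℕ.* (stairHeight m ℕ.+ 1)) ℕ.+ 1) where

  private
    <K : ∀ {j} → j ≤ n ℕ.+ stairHeight m → j < K
    <K j≤ = subst (_ <_) (sym K≡) (s≤s j≤)
    h≤n+h : stairHeight m ≤ n ℕ.+ stairHeight m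
    h≤n+h = NP.m≤n+m (stairHeight m) n
    1<K : 1 < K
    1<K = <K (NP.≤-trans (s≤s z≤n) h≤n+h)
    h<K : ∀ j → j < stairHeight m → suc j < K
    h<K j j<h = <K (NP.≤-trans j<h h≤n+h)

  open Increasing a K a0 a-step
  open Growth (stairHeight m)

  cardAt : ℕ → ℕ
  cardAt t = card (S± (stairHeight m) (suc t ℕ.+ stairHeight m))

  open LinearGrowth cardAt n (stairHeight m ℕ.+ stairHeight m)
    (λ t t<n → S±-card-step (suc t) (<K (NP.+-monoˡ-≤ (stairHeight m) t<n)))

  cardAt-end : cardAt n ≤ stairLength m ℕ.+ n ℕ.* (stairHeight m ℕ.+ stairHeight m)
  cardAt-end = NP.≤-reflexive (begin
    cardAt n                                                   ≡⟨ subst (λ k → card (S± h k) ≡ (2 ℕ.* h ℕ.* k ∸ h ℕ.* (h ℕ.+ 1)) ℕ.+ 1) K≡ card≡ ⟩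
    (2 ℕ.* h ℕ.* suc (n ℕ.+ h) ∸ h ℕ.* (h ℕ.+ 1)) ℕ.+ 1          ≡⟨ cong (λ x → x ∸ h ℕ.* (h ℕ.+ 1) ℕ.+ 1) (eq₁ h n) ⟩
    (h ℕ.* (h ℕ.+ 1) ℕ.+ (h ℕ.* suc h ℕ.+ n ℕ.* (h ℕ.+ h)) ∸ h ℕ.* (h ℕ.+ 1)) ℕ.+ 1
                                                               ≡⟨ cong (ℕ._+ 1) (NP.m+n∸m≡n (h ℕ.* (h ℕ.+ 1)) _) ⟩
    h ℕ.* suc h ℕ.+ n ℕ.* (h ℕ.+ h) ℕ.+ 1                     ≡⟨ eq₂ h n ⟩
    h ℕ.* suc h ℕ.+ 1 ℕ.+ n ℕ.* (h ℕ.+ h)                     ≡⟨ cong (ℕ._+ n ℕ.* (h ℕ.+ h)) (sym (stairLength≡ m)) ⟩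
    stairLength m ℕ.+ n ℕ.* (h ℕ.+ h)                         ∎)
    where
    open ≡-Reasoning
    h : ℕ
    h = stairHeight m
    eq₁ : ∀ h n → 2 ℕ.* h ℕ.* suc (n ℕ.+ h) ≡ h ℕ.* (h ℕ.+ 1) ℕ.+ (h ℕ.* suc h ℕ.+ n ℕ.* (h ℕ.+ h))
    eq₁ = ℕ-solve-∀
    eq₂ : ∀ h n → h ℕ.* suc h ℕ.+ n ℕ.* (h ℕ.+ h) ℕ.+ 1 ≡ h ℕ.* suc h ℕ.+ 1 ℕ.+ n ℕ.* (h ℕ.+ h)
    eq₂ = ℕ-solve-∀

  -- As above: suc 0 + h is rewritten to suc h only under this cong.
  cardAt-0 : cardAt 0 ≡ card (S± (stairHeight m) (suc (stairHeight m)))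
  cardAt-0 = cong (λ k → card (S± (stairHeight m) k)) {suc 0 ℕ.+ stairHeight m} {suc (stairHeight m)} refl

  StartLarge : Set
  StartLarge = stairLength m ≤ card (S± (stairHeight m) (suc (stairHeight m)))

  start-tight : StartLarge → card (S± (stairHeight m) (suc (stairHeight m))) ≤ stairLength m
  start-tight start≥ =
    subst (_≤ stairLength m) cardAt-0 (start-exact (stairLength m) (subst (stairLength m ≤_) (sym cardAt-0) start≥) cardAt-end)

  steps-tight : StartLarge → ∀ j → 1 ≤ j → suc (j ℕ.+ stairHeight m) ≤ K → TightStep j
  steps-tight start≥ (suc t) _ j+h<K = step-exact (stairLength m) (subst (stairLength m ≤_) (sym cardAt-0) start≥) cardAt-end t
    (NP.+-cancelʳ-≤ (stairHeight m) (suc t) n (NP.≤-pred (subst (suc (suc t ℕ.+ stairHeight m) ≤_) K≡ j+h<K)))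

  A′-AP-from-1 : StartLarge → stairHeight m ℕ.+ 3 ≤ K → ∀ j → suc j < K → a (suc j) ≡ a 1 ℤ.+ (a 2 ℤ.- a 1) ℤ.* + j
  A′-AP-from-1 start≥ h+3≤K = Rigidity.AP-from-1 a K a0 a-step (stairHeight m) (NP.≤-trans (NP.n≤1+n 3) (NP.m≤m+n 4 m))
    (steps-tight start≥) (subst (_≤ K) (NP.+-comm (stairHeight m) 3) h+3≤K)

  -- The stair values of the first h terms of A′ = c + d·[0, k-2] are h(h+1)+1 sums, and there is a
  -- further one if c ≠ d; a tight start forces c = d.
  dilation-of-A′-AP : ∀ c d → (∀ j → suc j < K → a (suc j) ≡ c ℤ.+ d ℤ.* + j) → DilatedRange a K
  dilation-of-A′-AP c d a-AP = dilation-of-AP′ a a0 K c 1<K (λ j j<K → trans (a-AP j j<K) (cong (λ w → c ℤ.+ w ℤ.* + j) (sym c≡d)))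
    where
    2<K : 2 < K
    2<K = h<K 1 (NP.≤-trans (s≤s (s≤s z≤n)) (NP.m≤m+n 4 m))
    a₁≡c : a 1 ≡ c
    a₁≡c = trans (a-AP 0 1<K) (trans (cong (λ x → c ℤ.+ x) (ZP.*-zeroʳ d)) (ZP.+-identityʳ c))
    a₂≡c+d : a 2 ≡ c ℤ.+ d
    a₂≡c+d = trans (a-AP 1 2<K) (cong (λ x → c ℤ.+ x) (ZP.*-identityʳ d))
    c>0 : 0ℤ ℤ.< c
    c>0 = subst (0ℤ ℤ.<_) a₁≡c (a-pos 1 (s≤s z≤n) 1<K)
    d>0 : 0ℤ ℤ.< d
    d>0 = subst (0ℤ ℤ.<_) (trans (cong₂ ℤ._-_ a₂≡c+d a₁≡c) (eq c d)) (i<j⇒0<j-i (a-step 1 2<K))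
      where
      eq : ∀ c d → c ℤ.+ d ℤ.- c ≡ d
      eq = solve-∀
    open APStaircase a a0 c d (stairHeight m) (λ j j<h → a-AP j (h<K j j<h))
    open Values m NP.≤-refl c>0 d>0
    c≡d : c ≡ d
    c≡d with c ZP.≟ d
    ... | yes c≡d = c≡d
    ... | no c≢d = ⊥-elim (NP.<-irrefl refl (NP.<-≤-trans (stair-card-> c≢d) (start-tight stair-card-≥)))

  private
    elems≡ : ∀ N → elems a N ≡ applyUpTo a N
    elems≡ N = LP.map-upTo a N
    Aₕ≡ : take (suc (stairHeight m)) (elems a K) ≡ elems a (suc (stairHeight m))
    Aₕ≡ = trans (cong (take (suc (stairHeight m))) (elems≡ K))
      (trans (take-applyUpTo a (suc (stairHeight m)) K (<K h≤n+h)) (sym (elems≡ (suc (stairHeight m)))))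
    A′≡ : ∀ {N} → drop 1 (elems a (suc N)) ≡ applyUpTo (λ j → a (suc j)) N
    A′≡ {N} = LP.map-applyUpTo suc a N

  case-A-AP : IsAP (elems a K) → DilatedRange a K
  case-A-AP A-AP with IsAP-applyUpTo⁻ a K (subst IsAP (elems≡ K) A-AP)
  ... | c , d , a-AP = dilation-of-AP a a0 K c d 1<K a-AP

  case-Aₕ-AP : IsAP (take (suc (stairHeight m)) (elems a K)) → DilatedRange a K
  case-Aₕ-AP Aₕ-AP with IsAP-applyUpTo⁻ a (suc (stairHeight m)) (subst IsAP (trans Aₕ≡ (elems≡ (suc (stairHeight m)))) Aₕ-AP)
  ... | c , d , a-AP = by-n n refl
    where
    a-AP≤h : ∀ j → j ≤ stairHeight m → a j ≡ a 1 ℤ.* + j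
    a-AP≤h j j≤h = dilation-of-AP a a0 (suc (stairHeight m)) c d (s≤s (NP.≤-trans (s≤s z≤n) (NP.m≤m+n 4 m))) a-AP j (s≤s j≤h)
    a-AP′ : ∀ j → j < stairHeight m → a (suc j) ≡ a 1 ℤ.+ a 1 ℤ.* + j
    a-AP′ j j<h = trans (a-AP≤h (suc j) j<h) (eq (a 1) (+ j))
      where
      eq : ∀ d y → d ℤ.* (+ 1 ℤ.+ y) ≡ d ℤ.+ d ℤ.* y
      eq = solve-∀
    a₁>0 : 0ℤ ℤ.< a 1
    a₁>0 = a-pos 1 (s≤s z≤n) 1<K
    start≥ : StartLarge
    start≥ = APStaircase.Values.stair-card-≥ a a0 (a 1) (a 1) (stairHeight m) a-AP′ m NP.≤-refl a₁>0 a₁>0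
    by-n : ∀ n₀ → n₀ ≡ n → DilatedRange a K
    by-n zero refl j j<K = a-AP≤h j (NP.≤-pred (subst (j <_) K≡ j<K))
    by-n (suc zero) refl j j<K with NP.m≤n⇒m<n∨m≡n (NP.≤-pred (subst (j <_) K≡ j<K))
    ... | inj₁ j≤h = a-AP≤h j (NP.≤-pred j≤h)
    ... | inj₂ refl = NextTerm.next-term m a a0 (λ i i<h+2 → a-step i (subst (suc i <_) (sym K≡) i<h+2)) a-AP≤h
      (start-tight start≥) (steps-tight start≥ 1 NP.≤-refl (subst (suc (suc (stairHeight m)) ≤_) (sym K≡) NP.≤-refl))
    by-n (suc (suc n′)) refl = dilation-of-AP′ a a0 K (a 1) 1<K λ j j<K →
      trans (A′-AP-from-1 start≥ h+3≤K j j<K) (cong (λ w → a 1 ℤ.+ w ℤ.* + j) a₂-a₁≡a₁)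
      where
      h+3≤K : stairHeight m ℕ.+ 3 ≤ K
      h+3≤K = subst (stairHeight m ℕ.+ 3 ≤_) (sym K≡) (NP.≤-trans (NP.≤-reflexive (NP.+-comm (stairHeight m) 3))
        (s≤s (s≤s (s≤s (NP.m≤n+m (stairHeight m) n′)))))
      a₂-a₁≡a₁ : a 2 ℤ.- a 1 ≡ a 1
      a₂-a₁≡a₁ = trans (cong (ℤ._- a 1) (a-AP≤h 2 (NP.≤-trans (s≤s (s≤s z≤n)) (NP.m≤m+n 4 m)))) (eq (a 1))
        where
        eq : ∀ x → x ℤ.* + 2 ℤ.- x ≡ x
        eq = solve-∀

  case-Aₕ-large : stairHeight m ℕ.* (stairHeight m ℕ.+ 1) ℕ.+ 1 ≤ card (stairHeight m ^∧± take (suc (stairHeight m)) (elems a K)) →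
    stairHeight m ℕ.+ 3 ≤ K → DilatedRange a K
  case-Aₕ-large Aₕ-large h+3≤K = dilation-of-A′-AP (a 1) (a 2 ℤ.- a 1) (A′-AP-from-1 start≥ h+3≤K)
    where
    start≥ : StartLarge
    start≥ = subst₂ _≤_ (trans (cong (λ w → stairHeight m ℕ.* w ℕ.+ 1) (NP.+-comm (stairHeight m) 1)) (sym (stairLength≡ m)))
      (cong (λ xs → card (signedSums (stairHeight m) xs)) Aₕ≡) Aₕ-large

  case-A′-AP : IsAP (drop 1 (elems a K)) → DilatedRange a K
  case-A′-AP A′-AP with IsAP-applyUpTo⁻ (λ j → a (suc j)) (n ℕ.+ stairHeight m) (subst IsAP (trans (cong (λ k → drop 1 (elems a k)) K≡) A′≡) A′-AP)
  ... | c , d , a-AP = dilation-of-A′-AP c d (λ j j<K → a-AP j (NP.≤-pred (subst (suc j <_) K≡ j<K)))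

  Conditions : Set
  Conditions = let h = stairHeight m; A = elems a K; Aₕ = take (suc h) A; A′ = drop 1 A in
      IsAP A
    ⊎ IsAP Aₕ
    ⊎ (h ℕ.* (h ℕ.+ 1) ℕ.+ 1 ≤ card (h ^∧± Aₕ) × h ℕ.+ 3 ≤ K)
    ⊎ ((h ^∧± A) ≐ ((h ^∧ neg A′) ++ (h ^∧± Aₕ) ++ (h ^∧ A′)) × IsAP A′)
    ⊎ (h ℕ.* (h ℕ.+ 1) ℕ.+ 1 ≤ card (h ^∧± Aₕ) × IsAP A′)

  dilated : Conditions → DilatedRange a K
  dilated (inj₁ A-AP) = case-A-AP A-AP
  dilated (inj₂ (inj₁ Aₕ-AP)) = case-Aₕ-AP Aₕ-AP
  dilated (inj₂ (inj₂ (inj₁ (Aₕ-large , h+3≤K)))) = case-Aₕ-large Aₕ-large h+3≤K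
  dilated (inj₂ (inj₂ (inj₂ (inj₁ (_ , A′-AP))))) = case-A′-AP A′-AP
  dilated (inj₂ (inj₂ (inj₂ (inj₂ (_ , A′-AP))))) = case-A′-AP A′-AP

theorem2p8 : (h k : ℕ) → 4 ≤ h → suc h ≤ k →
    (a : ℕ → ℤ) → a 0 ≡ + 0 → (∀ i → suc i < k → a i ℤ.< a (suc i)) →
    let A = elems a k
        Ah = take (suc h) A
        A' = drop 1 A
    in card (h ^∧± A) ≡ (2 ℕ.* h ℕ.* k ∸ h ℕ.* (h ℕ.+ 1)) ℕ.+ 1 →
    (IsAP A
      ⊎ IsAP Ah
      ⊎ (h ℕ.* (h ℕ.+ 1) ℕ.+ 1 ≤ card (h ^∧± Ah) × h ℕ.+ 3 ≤ k)
      ⊎ ((h ^∧± A) ≐ ((h ^∧ neg A') ++ (h ^∧± Ah) ++ (h ^∧ A')) × IsAP A')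
      ⊎ (h ℕ.* (h ℕ.+ 1) ℕ.+ 1 ≤ card (h ^∧± Ah) × IsAP A')) →
    ∀ z → (z ∈ A → ∃[ j ] (j < k × z ≡ a 1 * + j))
        × ((∃[ j ] (j < k × z ≡ a 1 * + j)) → z ∈ A)
theorem2p8 (stairHeight m) k (s≤s (s≤s (s≤s (s≤s _)))) h<k a a0 a-step card≡ conditions =
  elems-dilation a a0 k (Extremal.dilated m n k k≡ a a0 a-step card≡ conditions)
  where
  n : ℕ
  n = proj₁ (NP.m≤n⇒∃[o]m+o≡n h<k)
  k≡ : k ≡ suc (n ℕ.+ stairHeight m)
  k≡ = trans (sym (proj₂ (NP.m≤n⇒∃[o]m+o≡n h<k))) (cong suc (NP.+-comm (stairHeight m) n))
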